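{- Let $n\ge2$ and $f\in\mathfrak{T}(2,n,*)$ with $|M_1(f)|>1$, and let $m=|\textup{Vert}(P(f))|$. Then $f$ is an $m$-threshold function, and $S(f,\mathfrak{T}(2,n,*))=S(f,\mathfrak{T}(2,n,m+1))$.
   Context: $E_n^2=\{0,\dots,n-1\}^2$, $M_1(f)=\{x\in E_n^2: f(x)=1\}$. A function $f:E_n^2\to\{0,1\}$ is $k$-threshold if there are reals $a_{ij}$ with $M_1(f)=\{x\in E_n^2: a_{i1}x_1+a_{i2}x_2\le a_{i0},\ i=1,\dots,k\}$; $\mathfrak{T}(2,n,k)$ is the class of $k$-threshold functions and $\mathfrak{T}(2,n,*)=\bigcup_k\mathfrak{T}(2,n,k)$. $P(f)=\textup{Conv}(M_1(f))$, $\textup{Vert}(P)$ is its vertex set. For $f\in\mathcal{C}$, $x$ is essential for $f$ with respect to $\mathcal{C}$ if some $g\in\mathcal{C}$ differs from $f$ exactly at $x$; $S(f,\mathcal{C})$ is the set of essential points.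
   Formalization: The coefficients $a_{ij}$ of the threshold inequalities, and the weights of the convex combinations that determine the vertex set of P(f), are rational rather than real. -}

module Defs where

open import Data.Nat using (ℕ)
open import Data.Fin using (Fin; toℕ)
open import Data.Bool using (Bool; true)
open import Data.Product using (_×_; _,_; Σ; ∃; proj₁; proj₂)
open import Data.List using (List; []; _∷_; map; foldr; length)
open import Data.List.Relation.Unary.All using (All)
open import Data.Rational using (ℚ; _+_; _*_; _≤_; 0ℚ; 1ℚ)
import Data.Integer as ℤ
open import Data.Rational using (_/_)
open import Relation.Binary.PropositionalEquality using (_≡_; _≢_)
open import Relation.Nullary using (¬_)
open import Function.Bundles using (_⇔_)

sumℚ : List ℚ → ℚ
sumℚ = foldr _+_ 0ℚ

Point : ℕ → Set
Point n = Fin n × Fin n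

coord : {n : ℕ} → Fin n → ℚ
coord i = ℤ.+ (toℕ i) / 1

Fun : ℕ → Set
Fun n = Point n → Bool

M₁ : {n : ℕ} → Fun n → Point n → Set
M₁ f x = f x ≡ true

Coeffs : Set
Coeffs = ℚ × ℚ × ℚ

satisfies : {n : ℕ} → Coeffs → Point n → Set
satisfies (a₀ , a₁ , a₂) (x₁ , x₂) = a₁ * coord x₁ + a₂ * coord x₂ ≤ a₀

IsThreshold : (n k : ℕ) → Fun n → Set
IsThreshold n k f =
  Σ (Fin k → Coeffs) λ a →
    (x : Point n) → (f x ≡ true) ⇔ ((i : Fin k) → satisfies (a i) x)

IsThreshold* : (n : ℕ) → Fun n → Set
IsThreshold* n f = ∃ λ k → IsThreshold n k f

Class : ℕ → Set₁
Class n = Fun n → Set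

Essential : {n : ℕ} → Class n → Fun n → Point n → Set
Essential C f x =
  Σ (Fun _) λ g → C g × (g x ≢ f x) × ((y : _) → y ≢ x → g y ≡ f y)

InConv : {n : ℕ} → (Point n → Set) → Point n → Set
InConv {n} S (p₁ , p₂) =
  Σ (List (ℚ × Point n)) λ ws →
    All (λ w → S (proj₂ w)) ws ×
    All (λ w → 0ℚ ≤ proj₁ w) ws ×
    (sumℚ (map proj₁ ws) ≡ 1ℚ) ×
    (sumℚ (map (λ w → proj₁ w * coord (proj₁ (proj₂ w))) ws) ≡ coord p₁) ×
    (sumℚ (map (λ w → proj₁ w * coord (proj₂ (proj₂ w))) ws) ≡ coord p₂)

-- x ∈ Vert(P(f)), P(f) = Conv(M_1(f)): x is an extreme point of P(f),
-- i.e. x ∈ M_1(f) and x is not a convex combination of the other points of M_1(f).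
IsVertex : {n : ℕ} → Fun n → Point n → Set
IsVertex f x = M₁ f x × ¬ InConv (λ y → M₁ f y × y ≢ x) x

{-# OPTIONS --safe #-}
-- Gift wrapping around M₁(f) yields, for every vertex v of P(f), the next vertex.  When M₁(f) is
-- not collinear, a grid point p in all m half-planes bounded by these edges lies in every
-- half-plane containing M₁(f): it lies in the cone of the two edges at the vertex extreme in the
-- direction of that half-plane.  So p satisfies every threshold representation of f, and f(p) = 1.
-- When M₁(f) lies on a line, its two extreme points A and B are vertices, and two half-planes
-- suffice: a thin strip through A and B, tilted against the line, misses every grid point off the
-- line because for those cross(y - x, p - x) is a nonzero integer.
-- For S(f, 𝔗(2,n,*)): if g adds x₀ to M₁(f), the vertices of P(g) lie among x₀ and those of P(f),
-- so g is (m+1)-threshold by the first part; if g removes x₀, one half-plane of a representation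
-- of g that excludes x₀, added to the m half-planes of f, cuts out M₁(g).
module Submission where

open import Defs
open import Data.Bool using (Bool; true; false)
import Data.Bool as Bool
open import Data.Empty using (⊥; ⊥-elim)
open import Data.Fin using (Fin; toℕ)
import Data.Fin as Fin
import Data.Fin.Properties as Fin
open import Data.Integer as ℤ using (ℤ)
import Data.Integer.Properties as ℤ
open import Data.List using (List; []; _∷_; map; length; lookup; allFin; cartesianProduct)
open import Data.List.Membership.Propositional using (_∈_)
open import Data.List.Membership.Propositional.Properties using (∈-allFin; ∈-cartesianProduct⁺)
open import Data.List.Relation.Unary.All as All using (All; []; _∷_)
open import Data.List.Relation.Unary.Any using (here; there; index)
open import Data.List.Relation.Unary.Any.Properties using (lookup-index)
open import Data.List.Relation.Unary.Unique.Propositional using (Unique)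
open import Data.Nat using (ℕ; _≥_; suc)
open import Data.Product using (Σ; ∃; _×_; _,_; proj₁; proj₂; swap; uncurry)
open import Data.Product.Properties using (≡-dec)
open import Data.Rational as ℚ using (ℚ; 0ℚ; 1ℚ; _+_; _*_; _-_; -_; _≤_; _<_; 1/_; _⊔_)
import Data.Rational.Properties as ℚ
import Data.Rational.Unnormalised as ℚᵘ
import Data.Rational.Unnormalised.Properties as ℚᵘ
open import Data.Rational.Solver using (module +-*-Solver)
open import Data.Sum using (_⊎_; inj₁; inj₂; [_,_]′)
open import Function using (_∘_; id)
open import Function.Bundles using (_⇔_; mk⇔; Equivalence)
open import Relation.Binary.Definitions using (DecidableEquality; Tri; tri<; tri≈; tri>)
open import Relation.Binary.PropositionalEquality
open import Relation.Nullary using (¬_; Dec; yes; no)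
open import Relation.Nullary.Decidable using (_×-dec_; _⊎-dec_; _→-dec_; ¬?; map′; decidable-stable)

open +-*-Solver

private variable
  p q r s : ℚ

-- Rational arithmetic

neg-involutive : ∀ p → - (- p) ≡ p
neg-involutive = solve 1 (λ p → :- (:- p) := p) refl

p≤q⇒0≤q-p : p ≤ q → 0ℚ ≤ q - p
p≤q⇒0≤q-p {p} {q} h = subst (_≤ q - p) (ℚ.+-inverseʳ p) (ℚ.+-monoˡ-≤ (- p) h)

p<q⇒0<q-p : p < q → 0ℚ < q - p
p<q⇒0<q-p {p} {q} h = subst (_< q - p) (ℚ.+-inverseʳ p) (ℚ.+-monoˡ-< (- p) h)

private
  q-p+p≡q : ∀ p q → (q - p) + p ≡ q
  q-p+p≡q = solve 2 (λ p q → (q :- p) :+ p := q) refl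

  q-p≡-[p-q] : ∀ p q → q - p ≡ - (p - q)
  q-p≡-[p-q] = solve 2 (λ p q → q :- p := :- (p :- q)) refl

0≤q-p⇒p≤q : 0ℚ ≤ q - p → p ≤ q
0≤q-p⇒p≤q {q} {p} h = subst₂ _≤_ (ℚ.+-identityˡ p) (q-p+p≡q p q) (ℚ.+-monoˡ-≤ p h)

0<q-p⇒p<q : 0ℚ < q - p → p < q
0<q-p⇒p<q {q} {p} h = subst₂ _<_ (ℚ.+-identityˡ p) (q-p+p≡q p q) (ℚ.+-monoˡ-< p h)

p-q≡0⇒p≡q : p - q ≡ 0ℚ → p ≡ q
p-q≡0⇒p≡q {p} {q} e = trans (sym (q-p+p≡q q p)) (trans (cong (_+ q) e) (ℚ.+-identityˡ q))

p-r≤q-r⇒p≤q : p - r ≤ q - r → p ≤ q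
p-r≤q-r⇒p≤q {p} {r} {q} h = 0≤q-p⇒p≤q (subst (0ℚ ≤_) eq (p≤q⇒0≤q-p h))
  where eq = solve 3 (λ p q r → (q :- r) :- (p :- r) := q :- p) refl p q r

p-r≡q-r⇒p≡q : p - r ≡ q - r → p ≡ q
p-r≡q-r⇒p≡q {p} {r} {q} e = trans (sym (q-p+p≡q r p)) (trans (cong (_+ r) e) (q-p+p≡q r q))

0≤-p⇒p≤0 : 0ℚ ≤ - p → p ≤ 0ℚ
0≤-p⇒p≤0 {p} h = subst (_≤ 0ℚ) (neg-involutive p) (ℚ.neg-antimono-≤ h)

0<-p⇒p<0 : 0ℚ < - p → p < 0ℚ
0<-p⇒p<0 {p} h = subst (_< 0ℚ) (neg-involutive p) (ℚ.neg-antimono-< h)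

p≤q⇒p-q≤0 : p ≤ q → p - q ≤ 0ℚ
p≤q⇒p-q≤0 {p} {q} h = 0≤-p⇒p≤0 (subst (0ℚ ≤_) (q-p≡-[p-q] p q) (p≤q⇒0≤q-p h))

p<q⇒p-q<0 : p < q → p - q < 0ℚ
p<q⇒p-q<0 {p} {q} h = 0<-p⇒p<0 (subst (0ℚ <_) (q-p≡-[p-q] p q) (p<q⇒0<q-p h))

p-q≤0⇒p≤q : p - q ≤ 0ℚ → p ≤ q
p-q≤0⇒p≤q {p} {q} h = 0≤q-p⇒p≤q (subst (0ℚ ≤_) (sym (q-p≡-[p-q] p q)) (ℚ.neg-antimono-≤ h))

≤∧≢⇒< : p ≤ q → p ≢ q → p < q
≤∧≢⇒< {p} {q} h ne with ℚ.<-cmp p q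
... | tri< p<q _ _ = p<q
... | tri≈ _ p≡q _ = ⊥-elim (ne p≡q)
... | tri> _ _ q<p = ⊥-elim (ℚ.<-irrefl refl (ℚ.<-≤-trans q<p h))

*-nonNeg : 0ℚ ≤ p → 0ℚ ≤ q → 0ℚ ≤ p * q
*-nonNeg {p} {q} 0≤p 0≤q = ℚ.nonNegative⁻¹ (p * q)
  {{ℚ.nonNeg*nonNeg⇒nonNeg p {{ℚ.nonNegative 0≤p}} q {{ℚ.nonNegative 0≤q}}}}

*-pos : 0ℚ < p → 0ℚ < q → 0ℚ < p * q
*-pos {p} {q} 0<p 0<q = ℚ.positive⁻¹ (p * q) {{ℚ.pos*pos⇒pos p {{ℚ.positive 0<p}} q {{ℚ.positive 0<q}}}}

private
  -p*-q≡p*q : ∀ p q → (- p) * (- q) ≡ p * q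
  -p*-q≡p*q = solve 2 (λ p q → (:- p) :* (:- q) := p :* q) refl

  p*-q≡-[p*q] : ∀ p q → p * (- q) ≡ - (p * q)
  p*-q≡-[p*q] = solve 2 (λ p q → p :* (:- q) := :- (p :* q)) refl

*-nonNeg-nonPos : 0ℚ ≤ p → q ≤ 0ℚ → p * q ≤ 0ℚ
*-nonNeg-nonPos {p} {q} 0≤p q≤0 =
  0≤-p⇒p≤0 (subst (0ℚ ≤_) (p*-q≡-[p*q] p q) (*-nonNeg 0≤p (ℚ.neg-antimono-≤ q≤0)))

*-pos-neg : 0ℚ < p → q < 0ℚ → p * q < 0ℚ
*-pos-neg {p} {q} 0<p q<0 =
  0<-p⇒p<0 (subst (0ℚ <_) (p*-q≡-[p*q] p q) (*-pos 0<p (ℚ.neg-antimono-< q<0)))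

0≤p*p : ∀ p → 0ℚ ≤ p * p
0≤p*p p with ℚ.≤-total 0ℚ p
... | inj₁ 0≤p = *-nonNeg 0≤p 0≤p
... | inj₂ p≤0 = subst (0ℚ ≤_) (-p*-q≡p*q p p) (*-nonNeg (ℚ.neg-antimono-≤ p≤0) (ℚ.neg-antimono-≤ p≤0))

p≢0⇒0<p*p : p ≢ 0ℚ → 0ℚ < p * p
p≢0⇒0<p*p {p} p≢0 with ℚ.<-cmp p 0ℚ
... | tri< p<0 _ _ = subst (0ℚ <_) (-p*-q≡p*q p p) (*-pos (ℚ.neg-antimono-< p<0) (ℚ.neg-antimono-< p<0))
... | tri≈ _ p≡0 _ = ⊥-elim (p≢0 p≡0)
... | tri> _ _ 0<p = *-pos 0<p 0<p

p≢0⇒0<p*p+q*q : ∀ q → p ≢ 0ℚ → 0ℚ < p * p + q * q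
p≢0⇒0<p*p+q*q q p≢0 = ℚ.+-mono-<-≤ (p≢0⇒0<p*p p≢0) (0≤p*p q)

*-cancelˡ-0≤ : 0ℚ < r → 0ℚ ≤ r * p → 0ℚ ≤ p
*-cancelˡ-0≤ {r} {p} 0<r h = ℚ.*-cancelˡ-≤-pos r {{ℚ.positive 0<r}} (subst (_≤ r * p) (sym (ℚ.*-zeroʳ r)) h)

*-cancelˡ-≤0 : 0ℚ < r → r * p ≤ 0ℚ → p ≤ 0ℚ
*-cancelˡ-≤0 {r} {p} 0<r h =
  0≤-p⇒p≤0 (*-cancelˡ-0≤ 0<r (subst (0ℚ ≤_) (sym (p*-q≡-[p*q] r p)) (ℚ.neg-antimono-≤ h)))

*-cancelˡ-≡0 : 0ℚ < r → r * p ≡ 0ℚ → p ≡ 0ℚ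
*-cancelˡ-≡0 {r} 0<r e = ℚ.≤-antisym
  (*-cancelˡ-≤0 0<r (ℚ.≤-reflexive e)) (*-cancelˡ-0≤ 0<r (ℚ.≤-reflexive (sym e)))

*-cancelˡ-≡ : 0ℚ < r → r * p ≡ r * q → p ≡ q
*-cancelˡ-≡ {r} {p} {q} 0<r e = p-q≡0⇒p≡q (*-cancelˡ-≡0 0<r (begin
  r * (p - q)    ≡⟨ solve 3 (λ r p q → r :* (p :- q) := r :* p :- r :* q) refl r p q ⟩
  r * p - r * q  ≡⟨ cong (_- r * q) e ⟩
  r * q - r * q  ≡⟨ ℚ.+-inverseʳ (r * q) ⟩
  0ℚ             ∎))
  where open ≡-Reasoning

*-cancelʳ-<0 : 0ℚ < q → p * q < 0ℚ → p < 0ℚ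
*-cancelʳ-<0 {q} {p} 0<q pq<0 = ℚ.≰⇒> λ 0≤p →
  ℚ.<-irrefl refl (ℚ.≤-<-trans (*-nonNeg 0≤p (ℚ.<⇒≤ 0<q)) pq<0)

p<[p+1]*q : 0ℚ ≤ p → 1ℚ ≤ q → p < (p + 1ℚ) * q
p<[p+1]*q {p} {q} 0≤p 1≤q = ℚ.<-≤-trans p<p+1 (subst (_≤ (p + 1ℚ) * q) (ℚ.*-identityʳ (p + 1ℚ))
  (ℚ.*-monoˡ-≤-nonNeg (p + 1ℚ) {{ℚ.nonNegative (ℚ.≤-trans 0≤p (ℚ.<⇒≤ p<p+1))}} 1≤q))
  where
  p<p+1 : p < p + 1ℚ
  p<p+1 = subst (_< p + 1ℚ) (ℚ.+-identityʳ p) (ℚ.+-monoʳ-< p (ℚ.positive⁻¹ 1ℚ))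

drop-null-term : p ≡ q + r * s → r ≡ 0ℚ → p ≡ q
drop-null-term {q = q} {s = s} e refl = trans e (trans (cong (q +_) (ℚ.*-zeroˡ s)) (ℚ.+-identityʳ q))

drop-null-termˡ : p ≡ r * s + q → s ≡ 0ℚ → p ≡ q
drop-null-termˡ {r = r} {q = q} e refl = trans e (trans (cong (_+ q) (ℚ.*-zeroʳ r)) (ℚ.+-identityˡ q))

IsInteger : ℚ → Set
IsInteger p = ∃ λ z → ℚ.toℚᵘ p ℚᵘ.≃ ℚᵘ.mkℚᵘ z 0

coord-isInteger : ∀ {n} (i : Fin n) → IsInteger (coord i)
coord-isInteger i = ℤ.+ toℕ i , ℚ.toℚᵘ-fromℚᵘ (ℚᵘ.mkℚᵘ (ℤ.+ toℕ i) 0)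

+-isInteger : IsInteger p → IsInteger q → IsInteger (p + q)
+-isInteger {p} {q} (a , p≃a) (b , q≃b) = a ℤ.+ b ,
  ℚᵘ.≃-trans (ℚ.toℚᵘ-homo-+ p q) (ℚᵘ.≃-trans (ℚᵘ.+-cong p≃a q≃b)
    (ℚᵘ.*≡* (cong (ℤ._* ℤ.+ 1) (cong₂ ℤ._+_ (ℤ.*-identityʳ a) (ℤ.*-identityʳ b)))))

neg-isInteger : IsInteger p → IsInteger (- p)
neg-isInteger {p} (a , p≃a) = ℤ.- a , ℚᵘ.≃-trans (ℚ.toℚᵘ-homo‿- p) (ℚᵘ.-‿cong p≃a)

*-isInteger : IsInteger p → IsInteger q → IsInteger (p * q)
*-isInteger {p} {q} (a , p≃a) (b , q≃b) = a ℤ.* b ,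
  ℚᵘ.≃-trans (ℚ.toℚᵘ-homo-* p q) (ℚᵘ.*-cong p≃a q≃b)

-isInteger : IsInteger p → IsInteger q → IsInteger (p - q)
-isInteger ip iq = +-isInteger ip (neg-isInteger iq)

isInteger∧0<p⇒1≤p : IsInteger p → 0ℚ < p → 1ℚ ≤ p
isInteger∧0<p⇒1≤p {p} (z , p≃z) 0<p =
  ℚ.toℚᵘ-cancel-≤ (ℚᵘ.≤-respʳ-≃ (ℚᵘ.≃-sym p≃z) (ℚᵘ.*≤* 1≤z))
  where
  0<z : ℤ.+ 0 ℤ.< z
  0<z with ℚᵘ.<-respʳ-≃ p≃z (ℚ.toℚᵘ-mono-< 0<p)
  ... | ℚᵘ.*<* h = subst (ℤ.+ 0 ℤ.<_) (ℤ.*-identityʳ z) h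
  1≤z : ℤ.+ 1 ℤ.* ℤ.+ 1 ℤ.≤ z ℤ.* ℤ.+ 1
  1≤z = subst (ℤ.+ 1 ℤ.≤_) (sym (ℤ.*-identityʳ z)) (ℤ.i<j⇒suc[i]≤j 0<z)

isInteger∧p<0⇒1≤-p : IsInteger p → p < 0ℚ → 1ℚ ≤ - p
isInteger∧p<0⇒1≤-p ip p<0 = isInteger∧0<p⇒1≤p (neg-isInteger ip) (ℚ.neg-antimono-< p<0)

-- Plane vectors

ℚ² : Set
ℚ² = ℚ × ℚ

-- Opaque, so that unification never unfolds rational arithmetic on grid coordinates.  For the
-- same reason, case splits in a context mentioning `satisfies` use helper functions instead of
-- `with`, which would normalise that context.
opaque
  dot : ℚ² → ℚ² → ℚ
  dot (a₁ , a₂) (b₁ , b₂) = a₁ * b₁ + a₂ * b₂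

  cross : ℚ² → ℚ² → ℚ
  cross (a₁ , a₂) (b₁ , b₂) = a₁ * b₂ - a₂ * b₁

sqNorm : ℚ² → ℚ
sqNorm a = dot a a

rot : ℚ² → ℚ²
rot (a₁ , a₂) = (a₂ , - a₁)

negate : ℚ² → ℚ²
negate (a₁ , a₂) = (- a₁ , - a₂)

tilt : ℚ → ℚ² → ℚ²
tilt K (d₁ , d₂) = (d₁ + K * d₂ , d₂ - K * d₁)

OriginInHull : ℚ² → ℚ² → ℚ² → Set
OriginInHull (a₁ , a₂) (b₁ , b₂) (c₁ , c₂) = Σ ℚ λ w₁ → Σ ℚ λ w₂ → Σ ℚ λ w₃ →
  0ℚ ≤ w₁ × 0ℚ ≤ w₂ × 0ℚ ≤ w₃ × 0ℚ < w₁ + w₂ + w₃ ×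
  w₁ * a₁ + w₂ * b₁ + w₃ * c₁ ≡ 0ℚ × w₁ * a₂ + w₂ * b₂ + w₃ * c₂ ≡ 0ℚ

opaque
  unfolding dot cross

  0≤sqNorm : ∀ a → 0ℚ ≤ sqNorm a
  0≤sqNorm (a₁ , a₂) = ℚ.+-mono-≤ (0≤p*p a₁) (0≤p*p a₂)

  0<sqNorm⊎≡0 : ∀ a → 0ℚ < sqNorm a ⊎ a ≡ (0ℚ , 0ℚ)
  0<sqNorm⊎≡0 (a₁ , a₂) with a₁ ℚ.≟ 0ℚ | a₂ ℚ.≟ 0ℚ
  ... | no a₁≢0  | _        = inj₁ (p≢0⇒0<p*p+q*q a₂ a₁≢0)
  ... | yes _    | no a₂≢0  =
    inj₁ (subst (0ℚ <_) (ℚ.+-comm (a₂ * a₂) (a₁ * a₁)) (p≢0⇒0<p*p+q*q a₁ a₂≢0))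
  ... | yes refl | yes refl = inj₂ refl

  dot-comm : ∀ a b → dot a b ≡ dot b a
  dot-comm (a₁ , a₂) (b₁ , b₂) = cong₂ _+_ (ℚ.*-comm a₁ b₁) (ℚ.*-comm a₂ b₂)

  dot-zeroʳ : ∀ a → dot a (0ℚ , 0ℚ) ≡ 0ℚ
  dot-zeroʳ (a₁ , a₂) = solve 2 (λ a₁ a₂ → a₁ :* con 0ℚ :+ a₂ :* con 0ℚ := con 0ℚ) refl a₁ a₂

  cross-zeroʳ : ∀ a → cross a (0ℚ , 0ℚ) ≡ 0ℚ
  cross-zeroʳ (a₁ , a₂) = solve 2 (λ a₁ a₂ → a₁ :* con 0ℚ :- a₂ :* con 0ℚ := con 0ℚ) refl a₁ a₂

  cross-antisym : ∀ a b → cross b a ≡ - cross a b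
  cross-antisym (a₁ , a₂) (b₁ , b₂) = solve 4 (λ a₁ a₂ b₁ b₂ →
    b₁ :* a₂ :- b₂ :* a₁ := :- (a₁ :* b₂ :- a₂ :* b₁)) refl a₁ a₂ b₁ b₂

  cross-self : ∀ a → cross a a ≡ 0ℚ
  cross-self (a₁ , a₂) = solve 2 (λ a₁ a₂ → a₁ :* a₂ :- a₂ :* a₁ := con 0ℚ) refl a₁ a₂

  dot-rot : ∀ a b → dot (rot a) b ≡ - cross a b
  dot-rot (a₁ , a₂) (b₁ , b₂) = solve 4 (λ a₁ a₂ b₁ b₂ →
    a₂ :* b₁ :+ (:- a₁) :* b₂ := :- (a₁ :* b₂ :- a₂ :* b₁)) refl a₁ a₂ b₁ b₂

  dot-negate : ∀ a b → dot (negate a) b ≡ - dot a b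
  dot-negate (a₁ , a₂) (b₁ , b₂) = solve 4 (λ a₁ a₂ b₁ b₂ →
    (:- a₁) :* b₁ :+ (:- a₂) :* b₂ := :- (a₁ :* b₁ :+ a₂ :* b₂)) refl a₁ a₂ b₁ b₂

  dot-tilt : ∀ K d r → dot (tilt K d) r ≡ dot d r - K * cross d r
  dot-tilt K (d₁ , d₂) (r₁ , r₂) = solve 5 (λ K d₁ d₂ r₁ r₂ →
    (d₁ :+ K :* d₂) :* r₁ :+ (d₂ :- K :* d₁) :* r₂
      := (d₁ :* r₁ :+ d₂ :* r₂) :- K :* (d₁ :* r₂ :- d₂ :* r₁))
    refl K d₁ d₂ r₁ r₂

  dot-swap : ∀ a b → dot (swap a) (swap b) ≡ dot a b
  dot-swap (a₁ , a₂) (b₁ , b₂) = ℚ.+-comm (a₂ * b₂) (a₁ * b₁)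

  cross-swap : ∀ a b → cross (swap a) (swap b) ≡ - cross a b
  cross-swap (a₁ , a₂) (b₁ , b₂) = solve 4 (λ a₁ a₂ b₁ b₂ →
    a₂ :* b₁ :- a₁ :* b₂ := :- (a₁ :* b₂ :- a₂ :* b₁)) refl a₁ a₂ b₁ b₂

  sqNorm-proj₁ : ∀ c a → sqNorm c * proj₁ a ≡ dot c a * proj₁ c - cross c a * proj₂ c
  sqNorm-proj₁ (c₁ , c₂) (a₁ , a₂) = solve 4 (λ c₁ c₂ a₁ a₂ →
    (c₁ :* c₁ :+ c₂ :* c₂) :* a₁
      := (c₁ :* a₁ :+ c₂ :* a₂) :* c₁ :- (c₁ :* a₂ :- c₂ :* a₁) :* c₂)
    refl c₁ c₂ a₁ a₂

  sqNorm-proj₂ : ∀ c a → sqNorm c * proj₂ a ≡ dot c a * proj₂ c + cross c a * proj₁ c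
  sqNorm-proj₂ (c₁ , c₂) (a₁ , a₂) = solve 4 (λ c₁ c₂ a₁ a₂ →
    (c₁ :* c₁ :+ c₂ :* c₂) :* a₂
      := (c₁ :* a₁ :+ c₂ :* a₂) :* c₂ :+ (c₁ :* a₂ :- c₂ :* a₁) :* c₁)
    refl c₁ c₂ a₁ a₂

  lagrange-cross : ∀ d a b → sqNorm d * cross a b ≡ dot d b * cross a d + cross d b * dot a d
  lagrange-cross (d₁ , d₂) (a₁ , a₂) (b₁ , b₂) = solve 6 (λ d₁ d₂ a₁ a₂ b₁ b₂ →
    (d₁ :* d₁ :+ d₂ :* d₂) :* (a₁ :* b₂ :- a₂ :* b₁)
      := (d₁ :* b₁ :+ d₂ :* b₂) :* (a₁ :* d₂ :- a₂ :* d₁)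
         :+ (d₁ :* b₂ :- d₂ :* b₁) :* (a₁ :* d₁ :+ a₂ :* d₂))
    refl d₁ d₂ a₁ a₂ b₁ b₂

  lagrange-dot : ∀ d a b → sqNorm d * dot a b ≡ dot d a * dot d b + cross d a * cross d b
  lagrange-dot (d₁ , d₂) (a₁ , a₂) (b₁ , b₂) = solve 6 (λ d₁ d₂ a₁ a₂ b₁ b₂ →
    (d₁ :* d₁ :+ d₂ :* d₂) :* (a₁ :* b₁ :+ a₂ :* b₂)
      := (d₁ :* a₁ :+ d₂ :* a₂) :* (d₁ :* b₁ :+ d₂ :* b₂)
         :+ (d₁ :* a₂ :- d₂ :* a₁) :* (d₁ :* b₂ :- d₂ :* b₁))
    refl d₁ d₂ a₁ a₂ b₁ b₂

  lagrange-dot-sub : ∀ d a b → sqNorm d * (sqNorm a - dot a b)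
                                ≡ dot d a * (dot d a - dot d b) + cross d a * (cross d a - cross d b)
  lagrange-dot-sub (d₁ , d₂) (a₁ , a₂) (b₁ , b₂) = solve 6 (λ d₁ d₂ a₁ a₂ b₁ b₂ →
    (d₁ :* d₁ :+ d₂ :* d₂) :* ((a₁ :* a₁ :+ a₂ :* a₂) :- (a₁ :* b₁ :+ a₂ :* b₂))
      := (d₁ :* a₁ :+ d₂ :* a₂) :* ((d₁ :* a₁ :+ d₂ :* a₂) :- (d₁ :* b₁ :+ d₂ :* b₂))
         :+ (d₁ :* a₂ :- d₂ :* a₁) :* ((d₁ :* a₂ :- d₂ :* a₁) :- (d₁ :* b₂ :- d₂ :* b₁)))
    refl d₁ d₂ a₁ a₂ b₁ b₂

  cramer-dot : ∀ a b c r → cross a b * dot c r ≡ cross r b * dot c a + cross a r * dot c b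
  cramer-dot (a₁ , a₂) (b₁ , b₂) (c₁ , c₂) (r₁ , r₂) =
    solve 8 (λ a₁ a₂ b₁ b₂ c₁ c₂ r₁ r₂ →
    (a₁ :* b₂ :- a₂ :* b₁) :* (c₁ :* r₁ :+ c₂ :* r₂)
      := (r₁ :* b₂ :- r₂ :* b₁) :* (c₁ :* a₁ :+ c₂ :* a₂)
         :+ (a₁ :* r₂ :- a₂ :* r₁) :* (c₁ :* b₁ :+ c₂ :* b₂))
    refl a₁ a₂ b₁ b₂ c₁ c₂ r₁ r₂

  originInHull-turn : ∀ a b c → 0ℚ < cross a c → cross b c < 0ℚ → cross a b < 0ℚ → OriginInHull a b c
  originInHull-turn (a₁ , a₂) (b₁ , b₂) (c₁ , c₂) 0<ac bc<0 ab<0 =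
    - cross (b₁ , b₂) (c₁ , c₂) , cross (a₁ , a₂) (c₁ , c₂) , - cross (a₁ , a₂) (b₁ , b₂) ,
    ℚ.<⇒≤ 0<-bc , ℚ.<⇒≤ 0<ac , ℚ.<⇒≤ 0<-ab ,
    ℚ.+-mono-<-≤ (ℚ.+-mono-<-≤ 0<-bc (ℚ.<⇒≤ 0<ac)) (ℚ.<⇒≤ 0<-ab) ,
    solve 6 (λ a₁ a₂ b₁ b₂ c₁ c₂ →
      (:- (b₁ :* c₂ :- b₂ :* c₁)) :* a₁ :+ (a₁ :* c₂ :- a₂ :* c₁) :* b₁
        :+ (:- (a₁ :* b₂ :- a₂ :* b₁)) :* c₁ := con 0ℚ)
      refl a₁ a₂ b₁ b₂ c₁ c₂ ,
    solve 6 (λ a₁ a₂ b₁ b₂ c₁ c₂ →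
      (:- (b₁ :* c₂ :- b₂ :* c₁)) :* a₂ :+ (a₁ :* c₂ :- a₂ :* c₁) :* b₂
        :+ (:- (a₁ :* b₂ :- a₂ :* b₁)) :* c₂ := con 0ℚ)
      refl a₁ a₂ b₁ b₂ c₁ c₂
    where
    0<-bc : 0ℚ < - cross (b₁ , b₂) (c₁ , c₂)
    0<-bc = ℚ.neg-antimono-< bc<0
    0<-ab : 0ℚ < - cross (a₁ , a₂) (b₁ , b₂)
    0<-ab = ℚ.neg-antimono-< ab<0

  originInHull-opposite : ∀ a b → 0ℚ < sqNorm b → cross a b ≡ 0ℚ → dot a b ≤ 0ℚ → OriginInHull a b b
  originInHull-opposite (a₁ , a₂) (b₁ , b₂) 0<|b|² ab≡0 ab≤0 =
    sqNorm (b₁ , b₂) , - dot (a₁ , a₂) (b₁ , b₂) , 0ℚ ,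
    ℚ.<⇒≤ 0<|b|² , ℚ.neg-antimono-≤ ab≤0 , ℚ.≤-refl ,
    subst (0ℚ <_) (sym (ℚ.+-identityʳ _)) (ℚ.+-mono-<-≤ 0<|b|² (ℚ.neg-antimono-≤ ab≤0)) ,
    drop-null-term (solve 4 (λ a₁ a₂ b₁ b₂ →
      (b₁ :* b₁ :+ b₂ :* b₂) :* a₁ :+ (:- (a₁ :* b₁ :+ a₂ :* b₂)) :* b₁ :+ con 0ℚ :* b₁
        := con 0ℚ :+ (a₁ :* b₂ :- a₂ :* b₁) :* b₂) refl a₁ a₂ b₁ b₂) ab≡0 ,
    drop-null-term (solve 4 (λ a₁ a₂ b₁ b₂ →
      (b₁ :* b₁ :+ b₂ :* b₂) :* a₂ :+ (:- (a₁ :* b₁ :+ a₂ :* b₂)) :* b₂ :+ con 0ℚ :* b₂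
        := con 0ℚ :+ (a₁ :* b₂ :- a₂ :* b₁) :* (:- b₁)) refl a₁ a₂ b₁ b₂) ab≡0

private variable
  a b c e : ℚ²

dot-cross-injective : ∀ c a b → 0ℚ < sqNorm c → dot c a ≡ dot c b → cross c a ≡ cross c b → a ≡ b
dot-cross-injective c a b 0<|c|² dot≡ cross≡ = cong₂ _,_
  (*-cancelˡ-≡ 0<|c|² (begin
    sqNorm c * proj₁ a                       ≡⟨ sqNorm-proj₁ c a ⟩
    dot c a * proj₁ c - cross c a * proj₂ c  ≡⟨ cong₂ (λ s t → s * proj₁ c - t * proj₂ c) dot≡ cross≡ ⟩
    dot c b * proj₁ c - cross c b * proj₂ c  ≡⟨ sqNorm-proj₁ c b ⟨
    sqNorm c * proj₁ b                       ∎))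
  (*-cancelˡ-≡ 0<|c|² (begin
    sqNorm c * proj₂ a                       ≡⟨ sqNorm-proj₂ c a ⟩
    dot c a * proj₂ c + cross c a * proj₁ c  ≡⟨ cong₂ (λ s t → s * proj₂ c + t * proj₁ c) dot≡ cross≡ ⟩
    dot c b * proj₂ c + cross c b * proj₁ c  ≡⟨ sqNorm-proj₂ c b ⟨
    sqNorm c * proj₂ b                       ∎))
  where open ≡-Reasoning

dot-cross-zero : ∀ c a → 0ℚ < sqNorm c → dot c a ≡ 0ℚ → cross c a ≡ 0ℚ → a ≡ (0ℚ , 0ℚ)
dot-cross-zero c a 0<|c|² ca≡0 ca≡0′ = dot-cross-injective c a (0ℚ , 0ℚ) 0<|c|²
  (trans ca≡0 (sym (dot-zeroʳ c))) (trans ca≡0′ (sym (cross-zeroʳ c)))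

originInHull-swap : OriginInHull (swap a) (swap b) (swap c) → OriginInHull a b c
originInHull-swap (w₁ , w₂ , w₃ , 0≤w₁ , 0≤w₂ , 0≤w₃ , 0<w , e₂ , e₁) =
  w₁ , w₂ , w₃ , 0≤w₁ , 0≤w₂ , 0≤w₃ , 0<w , e₁ , e₂

data Beyond (c q : ℚ²) : Set where
  clockwise : cross c q < 0ℚ → Beyond c q
  farther   : cross c q ≡ 0ℚ → sqNorm c < dot c q → Beyond c q

beyond? : ∀ c q → Dec (Beyond c q)
beyond? c q = map′ [ clockwise , uncurry farther ]′ from-beyond
  ((cross c q ℚ.<? 0ℚ) ⊎-dec ((cross c q ℚ.≟ 0ℚ) ×-dec (sqNorm c ℚ.<? dot c q)))
  where
  from-beyond : Beyond c q → cross c q < 0ℚ ⊎ (cross c q ≡ 0ℚ × sqNorm c < dot c q)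
  from-beyond (clockwise cq<0)      = inj₁ cq<0
  from-beyond (farther cq≡0 |c|²<cq) = inj₂ (cq≡0 , |c|²<cq)

record Within (c e : ℚ²) : Set where
  constructor within
  field
    turn : 0ℚ ≤ cross c e
    near : cross c e ≡ 0ℚ → dot c e ≤ sqNorm c

within⇒¬beyond : Within c e → ¬ Beyond c e
within⇒¬beyond (within 0≤ce _) (clockwise ce<0) = ℚ.<-irrefl refl (ℚ.≤-<-trans 0≤ce ce<0)
within⇒¬beyond (within _ ce≤) (farther ce≡0 <ce) = ℚ.<-irrefl refl (ℚ.≤-<-trans (ce≤ ce≡0) <ce)

¬beyond⇒within : ¬ Beyond c e → Within c e
¬beyond⇒within ¬b = within (ℚ.≮⇒≥ (¬b ∘ clockwise)) λ ce≡0 → ℚ.≮⇒≥ (¬b ∘ farther ce≡0)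

within-refl : ∀ c → Within c c
within-refl c = within (ℚ.≤-reflexive (sym (cross-self c))) λ _ → ℚ.≤-refl

within-zero : ∀ c → Within c (0ℚ , 0ℚ)
within-zero c = within (ℚ.≤-reflexive (sym (cross-zeroʳ c)))
  λ _ → ℚ.≤-trans (ℚ.≤-reflexive (dot-zeroʳ c)) (0≤sqNorm c)

-- The invariant of the gift-wrapping scan; the scan is centred at a vertex, which provides the
-- two OriginInHull hypotheses.
within-transfer : ∀ c q e → 0ℚ < sqNorm c → 0ℚ < sqNorm e → ¬ OriginInHull c e e → ¬ OriginInHull c q e →
                  Beyond c q → Within c e → Within q e
within-transfer c q e 0<|c|² 0<|e|² ¬opposite ¬turn (clockwise cq<0) (within 0≤ce _) =
  within 0≤qe qe≡0⇒qe≤|q|²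
  where
  0<qc : 0ℚ < cross q c
  0<qc = subst (0ℚ <_) (sym (cross-antisym c q)) (ℚ.neg-antimono-< cq<0)

  0≤qe : 0ℚ ≤ cross q e
  0≤qe = ℚ.≮⇒≥ λ qe<0 → refute qe<0 (ℚ.<-cmp 0ℚ (cross c e))
    where
    refute : cross q e < 0ℚ → Tri (0ℚ < cross c e) (0ℚ ≡ cross c e) (cross c e < 0ℚ) → ⊥
    refute qe<0 (tri< 0<ce _ _) = ¬turn (originInHull-turn c q e 0<ce qe<0 cq<0)
    refute qe<0 (tri≈ _ 0≡ce _) = ¬opposite (originInHull-opposite c e 0<|e|² (sym 0≡ce) (ℚ.<⇒≤ ce<0))
      where
      ce<0 : dot c e < 0ℚ
      ce<0 = *-cancelʳ-<0 0<qc
        (subst (_< 0ℚ) (drop-null-term (lagrange-cross c q e) (sym 0≡ce)) (*-pos-neg 0<|c|² qe<0))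
    refute _ (tri> _ _ ce<0) = ℚ.<-irrefl refl (ℚ.≤-<-trans 0≤ce ce<0)

  qe≡0⇒qe≤|q|² : cross q e ≡ 0ℚ → dot q e ≤ sqNorm q
  qe≡0⇒qe≤|q|² qe≡0 = ℚ.≮⇒≥ λ |q|²<qe → ℚ.<-irrefl refl (ℚ.≤-<-trans
    (*-nonNeg (0≤sqNorm q) 0≤ce)
    (subst (_< 0ℚ) (sym (drop-null-term (lagrange-cross q c e) qe≡0))
      (*-pos-neg (ℚ.≤-<-trans (0≤sqNorm q) |q|²<qe) cq<0)))
within-transfer c q e 0<|c|² _ _ _ (farther cq≡0 |c|²<cq) (within 0≤ce ce≡0⇒ce≤|c|²) =
  within 0≤qe qe≡0⇒qe≤|q|²
  where
  0<cq : 0ℚ < dot c q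
  0<cq = ℚ.≤-<-trans (0≤sqNorm c) |c|²<cq

  along : sqNorm c * cross q e ≡ dot c q * cross c e
  along = begin
    sqNorm c * cross q e  ≡⟨ drop-null-termˡ {r = dot c e} (lagrange-cross c q e) qc≡0 ⟩
    cross c e * dot q c   ≡⟨ ℚ.*-comm (cross c e) (dot q c) ⟩
    dot q c * cross c e   ≡⟨ cong (_* cross c e) (dot-comm q c) ⟩
    dot c q * cross c e   ∎
    where
    open ≡-Reasoning
    qc≡0 : cross q c ≡ 0ℚ
    qc≡0 = trans (cross-antisym c q) (cong -_ cq≡0)

  0≤qe : 0ℚ ≤ cross q e
  0≤qe = *-cancelˡ-0≤ 0<|c|² (subst (0ℚ ≤_) (sym along) (*-nonNeg (ℚ.<⇒≤ 0<cq) 0≤ce))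

  qe≡0⇒qe≤|q|² : cross q e ≡ 0ℚ → dot q e ≤ sqNorm q
  qe≡0⇒qe≤|q|² qe≡0 = 0≤q-p⇒p≤q (*-cancelˡ-0≤ 0<|c|² (subst (0ℚ ≤_) (sym projection)
    (*-nonNeg (ℚ.<⇒≤ 0<cq) (p≤q⇒0≤q-p (ℚ.≤-trans (ce≡0⇒ce≤|c|² ce≡0) (ℚ.<⇒≤ |c|²<cq))))))
    where
    ce≡0 : cross c e ≡ 0ℚ
    ce≡0 = *-cancelˡ-≡0 0<cq (trans (sym along) (trans (cong (sqNorm c *_) qe≡0) (ℚ.*-zeroʳ (sqNorm c))))
    projection : sqNorm c * (sqNorm q - dot q e) ≡ dot c q * (dot c q - dot c e)
    projection = drop-null-term (lagrange-dot-sub c q e) cq≡0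

cross-along-ray : ∀ a b r → cross a b ≡ 0ℚ → sqNorm b * cross a r ≡ dot a b * cross b r
cross-along-ray a b r ab≡0 =
  trans (drop-null-termˡ {r = dot b r} (lagrange-cross b a r) ab≡0) (ℚ.*-comm (cross b r) (dot a b))

same-ray-cross-nonNeg : ∀ a b r → cross a b ≡ 0ℚ → 0ℚ < dot a b → 0ℚ ≤ cross a r → 0ℚ ≤ cross b r
same-ray-cross-nonNeg a b r ab≡0 0<ab 0≤ar =
  *-cancelˡ-0≤ 0<ab (subst (0ℚ ≤_) (cross-along-ray a b r ab≡0) (*-nonNeg (0≤sqNorm b) 0≤ar))

parallel-cross : ∀ a r s → 0ℚ < sqNorm a → cross a r ≡ 0ℚ → cross a s ≡ 0ℚ → cross r s ≡ 0ℚ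
parallel-cross a r s 0<|a|² ar≡0 as≡0 = *-cancelˡ-≡0 0<|a|² (begin
  sqNorm a * cross r s                   ≡⟨ drop-null-term (lagrange-cross a r s) as≡0 ⟩
  dot a s * cross r a                    ≡⟨ cong (dot a s *_) (trans (cross-antisym a r) (cong -_ ar≡0)) ⟩
  dot a s * 0ℚ                           ≡⟨ ℚ.*-zeroʳ (dot a s) ⟩
  0ℚ                                     ∎)
  where open ≡-Reasoning

cone-bound : ∀ a b c r → 0ℚ < cross a b → 0ℚ ≤ cross a r → 0ℚ ≤ cross r b →
             dot c a ≤ 0ℚ → dot c b ≤ 0ℚ → dot c r ≤ 0ℚ
cone-bound a b c r 0<ab 0≤ar 0≤rb ca≤0 cb≤0 = *-cancelˡ-≤0 0<ab
  (subst (_≤ 0ℚ) (sym (cramer-dot a b c r))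
    (ℚ.+-mono-≤ (*-nonNeg-nonPos 0≤rb ca≤0) (*-nonNeg-nonPos 0≤ar cb≤0)))

segment-bound : ∀ d b c r h → 0ℚ < sqNorm d → cross d b ≡ 0ℚ → cross d r ≡ 0ℚ →
                0ℚ < dot d b → 0ℚ ≤ dot d r → dot d r ≤ dot d b →
                0ℚ ≤ h → dot c b ≤ h → dot c r ≤ h
segment-bound d b c r h 0<N db≡0 dr≡0 0<tb 0≤tr tr≤tb 0≤h fb≤h =
  0≤q-p⇒p≤q (*-cancelˡ-0≤ 0<N (*-cancelˡ-0≤ 0<tb (subst (0ℚ ≤_) (sym interpolation)
    (ℚ.+-mono-≤ (*-nonNeg (p≤q⇒0≤q-p tr≤tb) (*-nonNeg (0≤sqNorm d) 0≤h))
                (*-nonNeg 0≤tr (*-nonNeg (0≤sqNorm d) (p≤q⇒0≤q-p fb≤h)))))))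
  where
  open ≡-Reasoning
  N = sqNorm d
  tb = dot d b
  tr = dot d r
  g = dot d c
  along : ∀ {s} → cross d s ≡ 0ℚ → N * dot c s ≡ dot d s * g
  along {s} ds≡0 = begin
    N * dot c s                          ≡⟨ cong (N *_) (dot-comm c s) ⟩
    N * dot s c                          ≡⟨ drop-null-term (lagrange-dot d s c) ds≡0 ⟩
    dot d s * g                          ∎
  interpolation : tb * (N * (h - dot c r)) ≡ (tb - tr) * (N * h) + tr * (N * (h - dot c b))
  interpolation = begin
    tb * (N * (h - dot c r))                          ≡⟨ expand ⟩
    tb * (N * h) - tb * (N * dot c r)                 ≡⟨ cong (λ t → tb * (N * h) - tb * t) (along dr≡0) ⟩
    tb * (N * h) - tb * (tr * g)                      ≡⟨ regroup ⟩
    (tb - tr) * (N * h) + tr * (N * h - tb * g)       ≡⟨ cong (λ t → (tb - tr) * (N * h) + tr * (N * h - t)) fb ⟨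
    (tb - tr) * (N * h) + tr * (N * h - N * dot c b)  ≡⟨ collect ⟩
    (tb - tr) * (N * h) + tr * (N * (h - dot c b))    ∎
    where
    expand = solve 4 (λ tb N h f → tb :* (N :* (h :- f)) := tb :* (N :* h) :- tb :* (N :* f)) refl tb N h (dot c r)
    regroup = solve 5 (λ tb tr N h g →
      tb :* (N :* h) :- tb :* (tr :* g) := (tb :- tr) :* (N :* h) :+ tr :* (N :* h :- tb :* g)) refl tb tr N h g
    fb = along db≡0
    collect = solve 5 (λ tb tr N h f →
      (tb :- tr) :* (N :* h) :+ tr :* (N :* h :- N :* f) := (tb :- tr) :* (N :* h) :+ tr :* (N :* (h :- f)))
      refl tb tr N h (dot c b)

module Scan {A : Set} (_≺_ : A → A → Set) (_≺?_ : ∀ c q → Dec (c ≺ q)) where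

  scan : A → List A → A
  scan c []       = c
  scan c (q ∷ qs) with c ≺? q
  ... | yes _ = scan q qs
  ... | no  _ = scan c qs

  module Invariant (Good : A → Set)
           (≺-good : ∀ {c q} → Good c → c ≺ q → Good q)
           (≺-transfer : ∀ {c q e} → Good c → c ≺ q → ¬ c ≺ e → ¬ q ≺ e)
           (≺-irrefl : ∀ {c} → Good c → ¬ c ≺ c) where

    scan-good : ∀ {c} qs → Good c → Good (scan c qs)
    scan-good []       g = g
    scan-good {c} (q ∷ qs) g with c ≺? q
    ... | yes c≺q = scan-good qs (≺-good g c≺q)
    ... | no  _   = scan-good qs g

    scan-keeps : ∀ {c e} qs → Good c → ¬ c ≺ e → ¬ scan c qs ≺ e
    scan-keeps []       _ c⊀e = c⊀e
    scan-keeps {c} (q ∷ qs) g c⊀e with c ≺? q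
    ... | yes c≺q = scan-keeps qs (≺-good g c≺q) (≺-transfer g c≺q c⊀e)
    ... | no  _   = scan-keeps qs g c⊀e

    scan-maximal : ∀ {c e} qs → Good c → e ∈ qs → ¬ scan c qs ≺ e
    scan-maximal {c} (q ∷ qs) g e∈ with c ≺? q | e∈
    ... | yes c≺q | here refl = scan-keeps qs (≺-good g c≺q) (≺-irrefl (≺-good g c≺q))
    ... | yes c≺q | there e∈qs = scan-maximal qs (≺-good g c≺q) e∈qs
    ... | no  c⊀q | here refl = scan-keeps qs g c⊀q
    ... | no  _   | there e∈qs = scan-maximal qs g e∈qs

bounded : ∀ {A : Set} (g : A → ℚ) (xs : List A) → ∃ λ M → 0ℚ ≤ M × (∀ {a} → a ∈ xs → g a ≤ M)
bounded g [] = 0ℚ , ℚ.≤-refl , λ ()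
bounded g (a ∷ xs) with bounded g xs
... | M , 0≤M , ≤M = g a ⊔ M , ℚ.≤-trans 0≤M (ℚ.p≤q⊔p (g a) M) ,
  λ { (here refl) → ℚ.p≤p⊔q (g a) M ; (there a∈xs) → ℚ.≤-trans (≤M a∈xs) (ℚ.p≤q⊔p (g a) M) }

length≡2+ : ∀ {A : Set} {a b : A} xs → a ∈ xs → b ∈ xs → a ≢ b → ∃ λ m → length xs ≡ suc (suc m)
length≡2+ (_ ∷ _)      (here refl) (here refl) a≢b = ⊥-elim (a≢b refl)
length≡2+ (_ ∷ _ ∷ xs) (here refl) (there _)   _   = length xs , refl
length≡2+ (_ ∷ _ ∷ xs) (there _)   (here refl) _   = length xs , refl
length≡2+ (_ ∷ xs)     (there a∈)  (there b∈)  a≢b with length≡2+ xs a∈ b∈ a≢b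
... | m , eq = suc m , cong suc eq

-- The grid

opaque
  pos : ∀ {n} → Point n → ℚ²
  pos (i , j) = (coord i , coord j)

  diff : ∀ {n} → Point n → Point n → ℚ²
  diff (i , j) (k , l) = (coord k - coord i , coord l - coord j)

points : ∀ n → List (Point n)
points n = cartesianProduct (allFin n) (allFin n)

∈-points : ∀ {n} (p : Point n) → p ∈ points n
∈-points (i , j) = ∈-cartesianProduct⁺ (∈-allFin i) (∈-allFin j)

module _ {n : ℕ} where

  _≟ₚ_ : DecidableEquality (Point n)
  _≟ₚ_ = ≡-dec Fin._≟_ Fin._≟_

  coord-injective : ∀ {i j : Fin n} → coord i ≡ coord j → i ≡ j
  coord-injective {i} {j} e with ℚᵘ.≃-trans (ℚᵘ.≃-sym (proj₂ (coord-isInteger i)))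
    (subst (λ x → ℚ.toℚᵘ x ℚᵘ.≃ ℚᵘ.mkℚᵘ (ℤ.+ toℕ j) 0) (sym e) (proj₂ (coord-isInteger j)))
  ... | ℚᵘ.*≡* i≡j =
    Fin.toℕ-injective (ℤ.+-injective (trans (sym (ℤ.*-identityʳ _)) (trans i≡j (ℤ.*-identityʳ _))))

  opaque
    unfolding dot cross pos diff

    diff-injective : ∀ {v p q : Point n} → diff v p ≡ diff v q → p ≡ q
    diff-injective e = cong₂ _,_ (coord-injective (p-r≡q-r⇒p≡q (cong proj₁ e)))
                                 (coord-injective (p-r≡q-r⇒p≡q (cong proj₂ e)))

    diff-self : ∀ (v : Point n) → diff v v ≡ (0ℚ , 0ℚ)
    diff-self (i , j) = cong₂ _,_ (ℚ.+-inverseʳ (coord i)) (ℚ.+-inverseʳ (coord j))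

    dot-diff : ∀ a (v p : Point n) → dot a (diff v p) ≡ dot a (pos p) - dot a (pos v)
    dot-diff (a₁ , a₂) (i , j) (k , l) = solve 6 (λ a₁ a₂ x y x' y' →
      a₁ :* (x' :- x) :+ a₂ :* (y' :- y) := (a₁ :* x' :+ a₂ :* y') :- (a₁ :* x :+ a₂ :* y))
      refl a₁ a₂ (coord i) (coord j) (coord k) (coord l)

    cross-diff-rebase : ∀ a (u v p : Point n) → cross a (diff u p) ≡ cross a (diff v p) - cross a (diff v u)
    cross-diff-rebase (a₁ , a₂) (i , j) (k , l) (i' , j') = solve 8 (λ a₁ a₂ x y x' y' x'' y'' →
      a₁ :* (y'' :- y) :- a₂ :* (x'' :- x)
        := (a₁ :* (y'' :- y') :- a₂ :* (x'' :- x')) :- (a₁ :* (y :- y') :- a₂ :* (x :- x')))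
      refl a₁ a₂ (coord i) (coord j) (coord k) (coord l) (coord i') (coord j')

    dot-diff-rebase : ∀ a (u v p : Point n) → dot a (diff u p) ≡ dot a (diff v p) - dot a (diff v u)
    dot-diff-rebase (a₁ , a₂) (i , j) (k , l) (i' , j') = solve 8 (λ a₁ a₂ x y x' y' x'' y'' →
      a₁ :* (x'' :- x) :+ a₂ :* (y'' :- y)
        := (a₁ :* (x'' :- x') :+ a₂ :* (y'' :- y')) :- (a₁ :* (x :- x') :+ a₂ :* (y :- y')))
      refl a₁ a₂ (coord i) (coord j) (coord k) (coord l) (coord i') (coord j')

    cross-diff-cycle : ∀ (u v p : Point n) → cross (diff u v) (diff u p) ≡ cross (diff v p) (diff v u)
    cross-diff-cycle (i , j) (k , l) (i' , j') = solve 6 (λ x y x' y' x'' y'' →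
      (x' :- x) :* (y'' :- y) :- (y' :- y) :* (x'' :- x) := (x'' :- x') :* (y :- y') :- (y'' :- y') :* (x :- x'))
      refl (coord i) (coord j) (coord k) (coord l) (coord i') (coord j')

    cross-diff-isInteger : ∀ (u v p : Point n) → IsInteger (cross (diff u v) (diff u p))
    cross-diff-isInteger (i , j) (k , l) (i' , j') = -isInteger
      (*-isInteger (Δ k i) (Δ j' j)) (*-isInteger (Δ l j) (Δ i' i))
      where
      Δ : ∀ (k i : Fin n) → IsInteger (coord k - coord i)
      Δ k i = -isInteger (coord-isInteger k) (coord-isInteger i)

    satisfies⇔dot : ∀ t (p : Point n) → satisfies t p ⇔ dot (proj₂ t) (pos p) ≤ proj₁ t
    satisfies⇔dot t p = mk⇔ id id

  satisfies-≡ : ∀ t t′ (p : Point n) → t ≡ t′ → satisfies t p → satisfies t′ p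
  satisfies-≡ t t′ p eq = subst (λ t → satisfies t p) eq

  0<sqNorm-diff : ∀ {v p : Point n} → p ≢ v → 0ℚ < sqNorm (diff v p)
  0<sqNorm-diff {v} {p} p≢v with 0<sqNorm⊎≡0 (diff v p)
  ... | inj₁ 0<|vp|² = 0<|vp|²
  ... | inj₂ vp≡0    = ⊥-elim (p≢v (diff-injective {v = v} (trans vp≡0 (sym (diff-self v)))))

  all-points? : {P : Point n → Set} → (∀ p → Dec (P p)) → Dec (∀ p → P p)
  all-points? P? = map′ (λ h p → h (proj₁ p) (proj₂ p)) (λ h i j → h (i , j))
    (Fin.all? λ i → Fin.all? λ j → P? (i , j))

  any-point? : {P : Point n → Set} → (∀ p → Dec (P p)) → Dec (∃ P)
  any-point? P? = map′ (λ { (i , j , h) → (i , j) , h }) (λ { ((i , j) , h) → i , j , h })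
    (Fin.any? λ i → Fin.any? λ j → P? (i , j))

halfPlane : ℚ² → ℚ → Coeffs
halfPlane a b = (b , a)

below : ∀ {n} → ℚ² → Point n → Coeffs
below a v = halfPlane a (dot a (pos v))

satisfies-below : ∀ {n} a (v p : Point n) → satisfies (below a v) p ⇔ dot a (diff v p) ≤ 0ℚ
satisfies-below a v p = mk⇔
  (λ h → subst (_≤ 0ℚ) (sym (dot-diff a v p)) (p≤q⇒p-q≤0 (Equivalence.to (satisfies⇔dot (below a v) p) h)))
  (λ h → Equivalence.from (satisfies⇔dot (below a v) p) (p-q≤0⇒p≤q (subst (_≤ 0ℚ) (dot-diff a v p) h)))

leftOf : ∀ {n} → Point n → Point n → Coeffs
leftOf v w = below (rot (diff v w)) v

satisfies-leftOf : ∀ {n} (v w p : Point n) → satisfies (leftOf v w) p ⇔ 0ℚ ≤ cross (diff v w) (diff v p)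
satisfies-leftOf v w p = mk⇔
  (λ h → subst (0ℚ ≤_) (neg-involutive (cross (diff v w) (diff v p))) (ℚ.neg-antimono-≤
    (subst (_≤ 0ℚ) (dot-rot (diff v w) (diff v p)) (Equivalence.to (satisfies-below (rot (diff v w)) v p) h))))
  (λ h → Equivalence.from (satisfies-below (rot (diff v w)) v p)
    (subst (_≤ 0ℚ) (sym (dot-rot (diff v w) (diff v p))) (ℚ.neg-antimono-≤ h)))

everywhere : Coeffs
everywhere = halfPlane (0ℚ , 0ℚ) 0ℚ

satisfies-everywhere : ∀ {n} (p : Point n) → satisfies everywhere p
satisfies-everywhere p = Equivalence.from (satisfies⇔dot everywhere p)
  (ℚ.≤-reflexive (trans (dot-comm (0ℚ , 0ℚ) (pos p)) (dot-zeroʳ (pos p))))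

module _ {n : ℕ} where

  totalWeight : List (ℚ × Point n) → ℚ
  totalWeight ws = sumℚ (map proj₁ ws)

  weightedSum : (Point n → ℚ) → List (ℚ × Point n) → ℚ
  weightedSum g ws = sumℚ (map (λ w → proj₁ w * g (proj₂ w)) ws)

  opaque
    unfolding dot diff

    weightedSum-dot-diff : ∀ a (v : Point n) ws →
      weightedSum (λ q → dot a (diff v q)) ws
        ≡ proj₁ a * (weightedSum (coord ∘ proj₁) ws - totalWeight ws * coord (proj₁ v))
        + proj₂ a * (weightedSum (coord ∘ proj₂) ws - totalWeight ws * coord (proj₂ v))
    weightedSum-dot-diff (a₁ , a₂) (i , j) [] = solve 4 (λ a₁ a₂ x y →
      con 0ℚ := a₁ :* (con 0ℚ :- con 0ℚ :* x) :+ a₂ :* (con 0ℚ :- con 0ℚ :* y)) refl a₁ a₂ (coord i) (coord j)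
    weightedSum-dot-diff (a₁ , a₂) (i , j) ((w , (k , l)) ∷ ws) =
      trans (cong (w * dot (a₁ , a₂) (diff (i , j) (k , l)) +_) (weightedSum-dot-diff (a₁ , a₂) (i , j) ws))
        (solve 10 (λ a₁ a₂ x y x' y' w sx sy sw →
          w :* (a₁ :* (x' :- x) :+ a₂ :* (y' :- y)) :+ (a₁ :* (sx :- sw :* x) :+ a₂ :* (sy :- sw :* y))
            := a₁ :* ((w :* x' :+ sx) :- (w :+ sw) :* x) :+ a₂ :* ((w :* y' :+ sy) :- (w :+ sw) :* y))
          refl a₁ a₂ (coord i) (coord j) (coord k) (coord l) w
          (weightedSum (coord ∘ proj₁) ws) (weightedSum (coord ∘ proj₂) ws) (totalWeight ws))

  weightedSum-dot-diff≡0 : ∀ a (v : Point n) ws → totalWeight ws ≡ 1ℚ →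
    weightedSum (coord ∘ proj₁) ws ≡ coord (proj₁ v) → weightedSum (coord ∘ proj₂) ws ≡ coord (proj₂ v) →
    weightedSum (λ q → dot a (diff v q)) ws ≡ 0ℚ
  weightedSum-dot-diff≡0 (a₁ , a₂) v ws w≡1 x≡ y≡ = begin
    weightedSum (λ q → dot (a₁ , a₂) (diff v q)) ws
      ≡⟨ weightedSum-dot-diff (a₁ , a₂) v ws ⟩
    a₁ * (weightedSum (coord ∘ proj₁) ws - totalWeight ws * x)
      + a₂ * (weightedSum (coord ∘ proj₂) ws - totalWeight ws * y)
      ≡⟨ cong₂ (λ sx sy → a₁ * (sx - totalWeight ws * x) + a₂ * (sy - totalWeight ws * y)) x≡ y≡ ⟩
    a₁ * (x - totalWeight ws * x) + a₂ * (y - totalWeight ws * y)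
      ≡⟨ cong (λ t → a₁ * (x - t * x) + a₂ * (y - t * y)) w≡1 ⟩
    a₁ * (x - 1ℚ * x) + a₂ * (y - 1ℚ * y)
      ≡⟨ solve 4 (λ a₁ a₂ x y → a₁ :* (x :- con 1ℚ :* x) :+ a₂ :* (y :- con 1ℚ :* y) := con 0ℚ) refl a₁ a₂ x y ⟩
    0ℚ ∎
    where
    open ≡-Reasoning
    x = coord (proj₁ v)
    y = coord (proj₂ v)

  data LexNegative (s₁ s₂ w : ℚ) : Set where
    first  : s₁ < 0ℚ → LexNegative s₁ s₂ w
    second : s₁ ≡ 0ℚ → s₂ < 0ℚ → LexNegative s₁ s₂ w
    null   : w ≡ 0ℚ → s₁ ≡ 0ℚ → s₂ ≡ 0ℚ → LexNegative s₁ s₂ w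

  lexNegative⇒≤0 : LexNegative p q r → p ≤ 0ℚ
  lexNegative⇒≤0 (first p<0)    = ℚ.<⇒≤ p<0
  lexNegative⇒≤0 (second p≡0 _) = ℚ.≤-reflexive p≡0
  lexNegative⇒≤0 (null _ p≡0 _) = ℚ.≤-reflexive p≡0

  LexBelow : (Point n → Set) → (h₁ h₂ : Point n → ℚ) → Set
  LexBelow S h₁ h₂ = ∀ s → S s → h₁ s ≤ 0ℚ × (h₁ s ≡ 0ℚ → h₂ s < 0ℚ)

  lexNegative-weightedSum : ∀ {S : Point n → Set} {h₁ h₂} → LexBelow S h₁ h₂ →
    ∀ ws → All (S ∘ proj₂) ws → All ((0ℚ ≤_) ∘ proj₁) ws →
    LexNegative (weightedSum h₁ ws) (weightedSum h₂ ws) (totalWeight ws)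
  lexNegative-weightedSum lex [] [] [] = null refl refl refl
  lexNegative-weightedSum {h₁ = h₁} {h₂} lex ((w , s) ∷ ws) (Ss ∷ Sws) (0≤w ∷ 0≤ws)
    with lexNegative-weightedSum lex ws Sws 0≤ws | lex s Ss | ℚ.<-cmp 0ℚ w
  ... | rest | _ | tri≈ _ refl _ =
    subst₃ LexNegative (zero-term (h₁ s)) (zero-term (h₂ s)) (sym (ℚ.+-identityˡ _)) rest
    where
    zero-term : ∀ x {y} → y ≡ 0ℚ * x + y
    zero-term x {y} = solve 2 (λ x y → y := con 0ℚ :* x :+ y) refl x y
    subst₃ : ∀ (P : ℚ → ℚ → ℚ → Set) {x x′ y y′ z z′} → x ≡ x′ → y ≡ y′ → z ≡ z′ → P x y z → P x′ y′ z′
    subst₃ P refl refl refl p = p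
  ... | _ | _ | tri> _ _ w<0 = ⊥-elim (ℚ.<-irrefl refl (ℚ.<-≤-trans w<0 0≤w))
  ... | rest | h₁s≤0 , h₁s≡0⇒ | tri< 0<w _ _ with ℚ.<-cmp (h₁ s) 0ℚ
  ...   | tri< h₁s<0 _ _ = first (ℚ.+-mono-<-≤ (*-pos-neg 0<w h₁s<0) (lexNegative⇒≤0 rest))
  ...   | tri> _ _ 0<h₁s = ⊥-elim (ℚ.<-irrefl refl (ℚ.<-≤-trans 0<h₁s h₁s≤0))
  ...   | tri≈ _ h₁s≡0 _ = extend rest
    where
    wh₁s≡0 : w * h₁ s ≡ 0ℚ
    wh₁s≡0 = trans (cong (w *_) h₁s≡0) (ℚ.*-zeroʳ w)
    wh₂s<0 : w * h₂ s < 0ℚ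
    wh₂s<0 = *-pos-neg 0<w (h₁s≡0⇒ h₁s≡0)
    extend : LexNegative (weightedSum h₁ ws) (weightedSum h₂ ws) (totalWeight ws) →
             LexNegative (w * h₁ s + weightedSum h₁ ws) (w * h₂ s + weightedSum h₂ ws) (w + totalWeight ws)
    extend (first S₁<0) = first (subst (_< 0ℚ) (sym (trans (cong (_+ _) wh₁s≡0) (ℚ.+-identityˡ _))) S₁<0)
    extend (second S₁≡0 S₂<0) = second (cong₂ _+_ wh₁s≡0 S₁≡0) (ℚ.+-mono-< wh₂s<0 S₂<0)
    extend (null _ S₁≡0 S₂≡0) = second (cong₂ _+_ wh₁s≡0 S₁≡0)
      (subst (_< 0ℚ) (sym (trans (cong (w * h₂ s +_) S₂≡0) (ℚ.+-identityʳ _))) wh₂s<0)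

  lexBelow⇒¬InConv : ∀ {S} a b (v : Point n) →
    LexBelow S (λ s → dot a (diff v s)) (λ s → dot b (diff v s)) → ¬ InConv S v
  lexBelow⇒¬InConv a b v lex (ws , Sws , 0≤ws , w≡1 , x≡ , y≡) =
    refute (lexNegative-weightedSum lex ws Sws 0≤ws)
    where
    refute : LexNegative (weightedSum (λ s → dot a (diff v s)) ws) (weightedSum (λ s → dot b (diff v s)) ws)
                         (totalWeight ws) → ⊥
    refute (first S₁<0)    = ℚ.<-irrefl (weightedSum-dot-diff≡0 a v ws w≡1 x≡ y≡) S₁<0
    refute (second _ S₂<0) = ℚ.<-irrefl (weightedSum-dot-diff≡0 b v ws w≡1 x≡ y≡) S₂<0
    refute (null w≡0 _ _)  = ℚ.1≢0 (trans (sym w≡1) w≡0)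

  opaque
    unfolding diff

    originInHull⇒InConv : ∀ {S : Point n → Set} {v a b c} → S a → S b → S c →
      OriginInHull (diff v a) (diff v b) (diff v c) → InConv S v
    originInHull⇒InConv {S} {v} {a} {b} {c} Sa Sb Sc (w₁ , w₂ , w₃ , 0≤w₁ , 0≤w₂ , 0≤w₃ , 0<W , e₁ , e₂) =
      ws , (Sa ∷ Sb ∷ Sc ∷ []) , (*-nonNeg 0≤w₁ 0≤1/W ∷ *-nonNeg 0≤w₂ 0≤1/W ∷ *-nonNeg 0≤w₃ 0≤1/W ∷ []) ,
      total , barycentre (coord ∘ proj₁) e₁ , barycentre (coord ∘ proj₂) e₂
      where
      open ≡-Reasoning
      W : ℚ
      W = w₁ + w₂ + w₃
      instance
        W≢0 : ℚ.NonZero W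
        W≢0 = ℚ.>-nonZero 0<W
      1/W : ℚ
      1/W = 1/ W
      0≤1/W : 0ℚ ≤ 1/W
      0≤1/W = ℚ.<⇒≤ (ℚ.positive⁻¹ 1/W {{ℚ.1/pos⇒pos W {{ℚ.positive 0<W}}}})
      ws : List (ℚ × Point n)
      ws = (w₁ * 1/W , a) ∷ (w₂ * 1/W , b) ∷ (w₃ * 1/W , c) ∷ []
      total : totalWeight ws ≡ 1ℚ
      total = trans (solve 4 (λ w₁ w₂ w₃ i → w₁ :* i :+ (w₂ :* i :+ (w₃ :* i :+ con 0ℚ)) := (w₁ :+ w₂ :+ w₃) :* i)
                             refl w₁ w₂ w₃ (1/W))
                    (ℚ.*-inverseʳ W)
      barycentre : ∀ (g : Point n → ℚ) → w₁ * (g a - g v) + w₂ * (g b - g v) + w₃ * (g c - g v) ≡ 0ℚ →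
                   weightedSum g ws ≡ g v
      barycentre g balanced = begin
        w₁ * 1/W * g a + (w₂ * 1/W * g b + (w₃ * 1/W * g c + 0ℚ))
          ≡⟨ solve 8 (λ w₁ w₂ w₃ i ga gb gc gv → w₁ :* i :* ga :+ (w₂ :* i :* gb :+ (w₃ :* i :* gc :+ con 0ℚ))
               := i :* (w₁ :* (ga :- gv) :+ w₂ :* (gb :- gv) :+ w₃ :* (gc :- gv)) :+ ((w₁ :+ w₂ :+ w₃) :* i) :* gv)
               refl w₁ w₂ w₃ (1/W) (g a) (g b) (g c) (g v) ⟩
        1/W * (w₁ * (g a - g v) + w₂ * (g b - g v) + w₃ * (g c - g v)) + (W * 1/W) * g v
          ≡⟨ cong₂ (λ s t → 1/W * s + t * g v) balanced (ℚ.*-inverseʳ W) ⟩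
        1/W * 0ℚ + 1ℚ * g v
          ≡⟨ solve 2 (λ i x → i :* con 0ℚ :+ con 1ℚ :* x := x) refl (1/W) (g v) ⟩
        g v ∎

-- Vertices

module Vertices {n : ℕ} (f : Fun n) where

  M₁? : ∀ p → Dec (M₁ f p)
  M₁? p = f p Bool.≟ true

  Others : Point n → Point n → Set
  Others v s = M₁ f s × s ≢ v

  Enclosed : Point n → Set
  Enclosed p = ∀ t → (∀ q → M₁ f q → satisfies t q) → satisfies t p

  enclosed⇒threshold : IsThreshold* n f → ∀ {k} (hs : Fin k → Coeffs) →
    (∀ p → M₁ f p → ∀ i → satisfies (hs i) p) → (∀ p → (∀ i → satisfies (hs i) p) → Enclosed p) →
    IsThreshold n k f
  enclosed⇒threshold (_ , a , f⇔a) hs M₁⊆hs hs⊆enclosed = hs , λ p → mk⇔ (M₁⊆hs p)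
    λ in-hs → Equivalence.from (f⇔a p) λ j → hs⊆enclosed p in-hs (a j) λ q Mq → Equivalence.to (f⇔a q) Mq j

  vertex⇒¬originInHull : ∀ {v a b c} → IsVertex f v → Others v a → Others v b → Others v c →
                         ¬ OriginInHull (diff v a) (diff v b) (diff v c)
  vertex⇒¬originInHull {v} {a} {b} {c} (_ , ¬conv) oa ob oc =
    ¬conv ∘ originInHull⇒InConv {v = v} {a} {b} {c} oa ob oc

  lexBelow⇒vertex : ∀ a b {v} → M₁ f v →
    LexBelow (Others v) (λ s → dot a (diff v s)) (λ s → dot b (diff v s)) → IsVertex f v
  lexBelow⇒vertex a b {v} Mv lex = Mv , lexBelow⇒¬InConv a b v lex

  module LexMax (x : Point n) (Mx : M₁ f x) (a b : ℚ²) where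

    LexLess : Point n → Point n → Set
    LexLess c q = dot a (pos c) < dot a (pos q) ⊎ (dot a (pos c) ≡ dot a (pos q) × dot b (pos c) < dot b (pos q))

    LexBetter : Point n → Point n → Set
    LexBetter c q = M₁ f q × LexLess c q

    lexBetter? : ∀ c q → Dec (LexBetter c q)
    lexBetter? c q = M₁? q ×-dec ((dot a (pos c) ℚ.<? dot a (pos q)) ⊎-dec
                                  ((dot a (pos c) ℚ.≟ dot a (pos q)) ×-dec (dot b (pos c) ℚ.<? dot b (pos q))))

    open Scan LexBetter lexBetter?

    lexMax : Point n
    lexMax = scan x (points n)

    private
      better-trans : ∀ {c q e} → LexBetter c q → ¬ LexBetter c e → ¬ LexBetter q e
      better-trans (_ , inj₁ c<q) c⊀e (Me , inj₁ q<e) = c⊀e (Me , inj₁ (ℚ.<-trans c<q q<e))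
      better-trans (_ , inj₁ c<q) c⊀e (Me , inj₂ (q≡e , _)) = c⊀e (Me , inj₁ (subst (_ <_) q≡e c<q))
      better-trans (_ , inj₂ (c≡q , _)) c⊀e (Me , inj₁ q<e) = c⊀e (Me , inj₁ (subst (_< _) (sym c≡q) q<e))
      better-trans (_ , inj₂ (c≡q , c<q)) c⊀e (Me , inj₂ (q≡e , q<e)) =
        c⊀e (Me , inj₂ (trans c≡q q≡e , ℚ.<-trans c<q q<e))

      better-irrefl : ∀ {c} → ¬ LexBetter c c
      better-irrefl (_ , inj₁ c<c) = ℚ.<-irrefl refl c<c
      better-irrefl (_ , inj₂ (_ , c<c)) = ℚ.<-irrefl refl c<c

    open Invariant (M₁ f) (λ _ → proj₁) (λ {c} {q} {e} _ → better-trans {c} {q} {e})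
                   (λ {c} _ → better-irrefl {c})

    lexMax-M₁ : M₁ f lexMax
    lexMax-M₁ = scan-good (points n) Mx

    lexMax-max : ∀ e → M₁ f e →
                 dot a (diff lexMax e) ≤ 0ℚ × (dot a (diff lexMax e) ≡ 0ℚ → dot b (diff lexMax e) ≤ 0ℚ)
    lexMax-max e Me = subst (_≤ 0ℚ) (sym (dot-diff a lexMax e)) (p≤q⇒p-q≤0 (ℚ.≮⇒≥ (not-better ∘ inj₁))) ,
      λ ae≡0 → subst (_≤ 0ℚ) (sym (dot-diff b lexMax e)) (p≤q⇒p-q≤0 (ℚ.≮⇒≥ λ lt →
        not-better (inj₂ (sym (p-q≡0⇒p≡q (trans (sym (dot-diff a lexMax e)) ae≡0)) , lt))))
      where
      not-better : ¬ LexLess lexMax e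
      not-better lt = scan-maximal (points n) Mx (∈-points e) (Me , lt)

    lexMax-vertex : (∀ e → Others lexMax e → dot a (diff lexMax e) ≡ 0ℚ → dot b (diff lexMax e) ≢ 0ℚ) →
                    IsVertex f lexMax
    lexMax-vertex unique = lexBelow⇒vertex a b lexMax-M₁ λ e oe@(Me , _) →
      proj₁ (lexMax-max e Me) , λ ae≡0 → ≤∧≢⇒< (proj₂ (lexMax-max e Me) ae≡0) (unique e oe ae≡0)

-- Gift wrapping

module Wrapping {n : ℕ} (f : Fun n) {x y : Point n} (x≢y : x ≢ y) (Mx : M₁ f x) (My : M₁ f y) where
  open Vertices f

  other : Point n → Point n
  other v with v ≟ₚ x
  ... | yes _ = y
  ... | no  _ = x

  other-Others : ∀ v → Others v (other v)
  other-Others v with v ≟ₚ x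
  ... | yes refl = My , x≢y ∘ sym
  ... | no  v≢x  = Mx , v≢x ∘ sym

  -- For σ = false the picture is reflected in the diagonal, so the same scan turns the other way.
  view : Bool → Point n → Point n → ℚ²
  view true  v p = diff v p
  view false v p = swap (diff v p)

  0<sqNorm-view : ∀ σ {v p} → p ≢ v → 0ℚ < sqNorm (view σ v p)
  0<sqNorm-view true  p≢v = 0<sqNorm-diff p≢v
  0<sqNorm-view false {v} {p} p≢v = subst (0ℚ <_) (sym (dot-swap (diff v p) (diff v p))) (0<sqNorm-diff p≢v)

  within-view-self : ∀ σ c v → Within c (view σ v v)
  within-view-self true  c v = subst (Within c) (sym (diff-self v)) (within-zero c)
  within-view-self false c v = subst (Within c ∘ swap) (sym (diff-self v)) (within-zero c)

  vertex⇒¬originInHull-view : ∀ σ {v a b c} → IsVertex f v → Others v a → Others v b → Others v c →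
                              ¬ OriginInHull (view σ v a) (view σ v b) (view σ v c)
  vertex⇒¬originInHull-view true  iv oa ob oc = vertex⇒¬originInHull iv oa ob oc
  vertex⇒¬originInHull-view false iv oa ob oc = vertex⇒¬originInHull iv oa ob oc ∘ originInHull-swap

  module _ (σ : Bool) (v : Point n) where

    Ahead : Point n → Point n → Set
    Ahead c q = M₁ f q × Beyond (view σ v c) (view σ v q)

    ahead? : ∀ c q → Dec (Ahead c q)
    ahead? c q = M₁? q ×-dec beyond? (view σ v c) (view σ v q)

    open Scan Ahead ahead?

    wrap : Point n
    wrap = scan (other v) (points n)

    module _ (iv : IsVertex f v) where

      private
        ahead-others : ∀ {c q} → Others v c → Ahead c q → Others v q
        ahead-others {c} _ (Mq , beyond) = Mq , λ { refl → within⇒¬beyond (within-view-self σ (view σ v c) v) beyond }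

        ahead-transfer : ∀ {c q e} → Others v c → Ahead c q → ¬ Ahead c e → ¬ Ahead q e
        ahead-transfer {c} {q} {e} oc c≺q c⊀e (Me , q≺e) with e ≟ₚ v
        ... | yes refl = within⇒¬beyond (within-view-self σ (view σ v q) v) q≺e
        ... | no  e≢v  = within⇒¬beyond
          (within-transfer (view σ v c) (view σ v q) (view σ v e)
             (0<sqNorm-view σ (proj₂ oc)) (0<sqNorm-view σ e≢v)
             (vertex⇒¬originInHull-view σ iv oc oe oe) (vertex⇒¬originInHull-view σ iv oc oq oe)
             (proj₂ c≺q) (¬beyond⇒within (λ c≺e → c⊀e (Me , c≺e))))
          q≺e
          where
          oe : Others v e
          oe = Me , e≢v
          oq : Others v q
          oq = ahead-others oc c≺q

        ahead-irrefl : ∀ {c} → Others v c → ¬ Ahead c c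
        ahead-irrefl {c} _ (_ , beyond) = within⇒¬beyond (within-refl (view σ v c)) beyond

      open Invariant (Others v) ahead-others ahead-transfer ahead-irrefl

      wrap-Others : Others v wrap
      wrap-Others = scan-good (points n) (other-Others v)

      wrap-within : ∀ e → M₁ f e → Within (view σ v wrap) (view σ v e)
      wrap-within e Me = ¬beyond⇒within λ beyond →
        scan-maximal (points n) (other-Others v) (∈-points e) (Me , beyond)

  next prev : Point n → Point n
  next = wrap true
  prev = wrap false

  Supporting : Point n → Set
  Supporting v = ∀ e → M₁ f e → 0ℚ ≤ cross (diff v (next v)) (diff v e)

  supporting? : ∀ v → Dec (Supporting v)
  supporting? v = all-points? λ e → M₁? e →-dec (0ℚ ℚ.≤? cross (diff v (next v)) (diff v e))

  edge-if : ∀ v → Dec (Supporting v) → Coeffs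
  edge-if v (yes _) = leftOf v (next v)
  edge-if v (no  _) = everywhere

  -- The test makes the definition total; for a vertex it always succeeds.
  edge : Point n → Coeffs
  edge v = edge-if v (supporting? v)

  edge-M₁ : ∀ v {p} → M₁ f p → satisfies (edge v) p
  edge-M₁ v {p} Mp = from-dec (supporting? v)
    where
    from-dec : (s? : Dec (Supporting v)) → satisfies (edge-if v s?) p
    from-dec (yes supp) = Equivalence.from (satisfies-leftOf v (next v) p) (supp p Mp)
    from-dec (no  _)    = satisfies-everywhere p

  edge-vertex : ∀ {v} p → IsVertex f v → satisfies (edge v) p → 0ℚ ≤ cross (diff v (next v)) (diff v p)
  edge-vertex {v} p iv = from-dec (supporting? v)
    where
    from-dec : (s? : Dec (Supporting v)) → satisfies (edge-if v s?) p → 0ℚ ≤ cross (diff v (next v)) (diff v p)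
    from-dec (yes _)     sat = Equivalence.to (satisfies-leftOf v (next v) p) sat
    from-dec (no  ¬supp) _   = ⊥-elim (¬supp λ e Me → Within.turn (wrap-within true v iv e Me))

  module _ {v : Point n} (iv : IsVertex f v) where

    prev-turn : ∀ e → M₁ f e → cross (diff v (prev v)) (diff v e) ≤ 0ℚ
    prev-turn e Me =
      0≤-p⇒p≤0 (subst (0ℚ ≤_) (cross-swap (diff v (prev v)) (diff v e)) (Within.turn (wrap-within false v iv e Me)))

    prev-near : ∀ e → M₁ f e → cross (diff v (prev v)) (diff v e) ≡ 0ℚ →
                       dot (diff v (prev v)) (diff v e) ≤ sqNorm (diff v (prev v))
    prev-near e Me ue≡0 = subst₂ _≤_ (dot-swap u (diff v e)) (dot-swap u u)
      (Within.near (wrap-within false v iv e Me) (trans (cross-swap u (diff v e)) (cong -_ ue≡0)))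
      where u = diff v (prev v)

    -- prev v is lexicographically extreme: first across the line through v and prev v, then
    -- along it away from v.
    prev-vertex : IsVertex f (prev v)
    prev-vertex = lexBelow⇒vertex (rot (diff u v)) (diff v u) (proj₁ (wrap-Others false v iv)) lex-below
      where
      u = prev v
      lex-below : LexBelow (Others u) (λ s → dot (rot (diff u v)) (diff u s)) (λ s → dot (diff v u) (diff u s))
      lex-below s (Ms , s≢u) = subst (_≤ 0ℚ) (sym first≡) (prev-turn s Ms) , second<0
        where
        first≡ : dot (rot (diff u v)) (diff u s) ≡ cross (diff v u) (diff v s)
        first≡ = begin
          dot (rot (diff u v)) (diff u s)     ≡⟨ dot-rot (diff u v) (diff u s) ⟩
          - cross (diff u v) (diff u s)       ≡⟨ cong -_ (cross-diff-cycle u v s) ⟩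
          - cross (diff v s) (diff v u)       ≡⟨ cong -_ (cross-antisym (diff v u) (diff v s)) ⟩
          - (- cross (diff v u) (diff v s))   ≡⟨ neg-involutive (cross (diff v u) (diff v s)) ⟩
          cross (diff v u) (diff v s)         ∎
          where open ≡-Reasoning
        second<0 : dot (rot (diff u v)) (diff u s) ≡ 0ℚ → dot (diff v u) (diff u s) < 0ℚ
        second<0 first≡0 = subst (_< 0ℚ) (sym (dot-diff-rebase (diff v u) u v s))
          (p<q⇒p-q<0 (≤∧≢⇒< (prev-near s Ms us≡0) λ us≡uu →
            s≢u (diff-injective {v = v} (dot-cross-injective (diff v u) (diff v s) (diff v u)
              (0<sqNorm-diff (proj₂ (wrap-Others false v iv))) us≡uu (trans us≡0 (sym (cross-self (diff v u))))))))
          where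
          us≡0 : cross (diff v u) (diff v s) ≡ 0ℚ
          us≡0 = trans (sym first≡) first≡0

    -- v lies on the line of the edge leaving prev v, on the same ray, so the half-plane of that
    -- edge is the one to the left of (prev v , v).
    prev-edge : ∀ p → satisfies (edge (prev v)) p → 0ℚ ≤ cross (diff (prev v) v) (diff (prev v) p)
    prev-edge p sat = same-ray-cross-nonNeg (diff u w) (diff u v) (diff u p) collinear aligned (edge-vertex p iu sat)
      where
      u = prev v
      w = next u
      iu : IsVertex f u
      iu = prev-vertex
      ow : Others u w
      ow = wrap-Others true u iu
      ov : Others u v
      ov = proj₁ iv , λ v≡u → proj₂ (wrap-Others false v iv) (sym v≡u)
      collinear : cross (diff u w) (diff u v) ≡ 0ℚ
      collinear = ℚ.≤-antisym
        (subst (_≤ 0ℚ) (cross-diff-cycle v u w) (prev-turn w (proj₁ ow)))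
        (Within.turn (wrap-within true u iu v (proj₁ iv)))
      aligned : 0ℚ < dot (diff u w) (diff u v)
      aligned = ℚ.≰⇒> λ ≤0 → vertex⇒¬originInHull iu ow ov ov
        (originInHull-opposite (diff u w) (diff u v) (0<sqNorm-diff (proj₂ ov)) collinear ≤0)

-- The non-collinear case

module NonCollinear {n : ℕ} (f : Fun n) {x y : Point n} (x≢y : x ≢ y) (Mx : M₁ f x) (My : M₁ f y)
                    {q₀ : Point n} (Mq₀ : M₁ f q₀) (q₀-off : cross (diff x y) (diff x q₀) ≢ 0ℚ) where
  open Vertices f
  open Wrapping f x≢y Mx My

  not-on-line : ∀ d v → 0ℚ < sqNorm d → ¬ (∀ e → M₁ f e → cross d (diff v e) ≡ 0ℚ)
  not-on-line d v 0<|d|² on-line =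
    q₀-off (parallel-cross d (diff x y) (diff x q₀) 0<|d|² (through-x y My) (through-x q₀ Mq₀))
    where
    through-x : ∀ e → M₁ f e → cross d (diff x e) ≡ 0ℚ
    through-x e Me = trans (cross-diff-rebase d x v e) (cong₂ _-_ (on-line e Me) (on-line x Mx))

  -- Parallel edges at v would put M₁ on a line, or v between two other points of M₁.
  wedge : ∀ {v} → IsVertex f v → 0ℚ < cross (diff v (next v)) (diff v (prev v))
  wedge {v} iv = ≤∧≢⇒< (Within.turn (wrap-within true v iv u (proj₁ ou))) (flat ∘ sym)
    where
    w = next v
    u = prev v
    ow : Others v w
    ow = wrap-Others true v iv
    ou : Others v u
    ou = wrap-Others false v iv
    flat : cross (diff v w) (diff v u) ≡ 0ℚ → ⊥
    flat wu≡0 = [ opposite , aligned ]′ (ℚ.≤-total (dot (diff v w) (diff v u)) 0ℚ)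
      where
      opposite : dot (diff v w) (diff v u) ≤ 0ℚ → ⊥
      opposite wu≤0 = vertex⇒¬originInHull iv ow ou ou
        (originInHull-opposite (diff v w) (diff v u) (0<sqNorm-diff (proj₂ ou)) wu≡0 wu≤0)
      aligned : 0ℚ ≤ dot (diff v w) (diff v u) → ⊥
      aligned 0≤wu = not-on-line (diff v w) v (0<sqNorm-diff (proj₂ ow)) λ e Me →
        *-cancelˡ-≡0 (0<sqNorm-diff (proj₂ ou)) (ℚ.≤-antisym
          (subst (_≤ 0ℚ) (sym (cross-along-ray (diff v w) (diff v u) (diff v e) wu≡0))
            (*-nonNeg-nonPos 0≤wu (prev-turn iv e Me)))
          (*-nonNeg (0≤sqNorm (diff v u)) (Within.turn (wrap-within true v iv e Me))))

  module _ (c : ℚ²) (0<|c|² : 0ℚ < sqNorm c) where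
    open LexMax x Mx c (rot c)

    extreme-vertex : IsVertex f lexMax
    extreme-vertex = lexMax-vertex λ e (_ , e≢m) ce≡0 rce≡0 →
      e≢m (diff-injective {v = lexMax} (trans
        (dot-cross-zero c (diff lexMax e) 0<|c|² ce≡0 (ℚ.neg-injective (trans (sym (dot-rot c (diff lexMax e))) rce≡0)))
        (sym (diff-self lexMax))))

    -- p lies in the cone of the two edges at the vertex extreme in direction c.
    edges⇒below-vertex : ∀ p → (∀ {v} → IsVertex f v → satisfies (edge v) p) →
                          ∃ λ v → M₁ f v × dot c (diff v p) ≤ 0ℚ
    edges⇒below-vertex p edges = lexMax , lexMax-M₁ , cone-bound (diff lexMax w) (diff lexMax u) c (diff lexMax p)
      (wedge iv) (edge-vertex p iv (edges iv))
      (subst (0ℚ ≤_) (cross-diff-cycle u lexMax p) (prev-edge iv p (edges (prev-vertex iv))))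
      (proj₁ (lexMax-max w (proj₁ (wrap-Others true lexMax iv))))
      (proj₁ (lexMax-max u (proj₁ (wrap-Others false lexMax iv))))
      where
      iv = extreme-vertex
      w = next lexMax
      u = prev lexMax

  edges⇒enclosed : ∀ p → (∀ {v} → IsVertex f v → satisfies (edge v) p) → Enclosed p
  edges⇒enclosed p edges (c₀ , c) M₁⊆t =
    Equivalence.from (satisfies⇔dot (c₀ , c) p) (by-cases (0<sqNorm⊎≡0 c))
    where
    below-c₀ : ∀ {q} → M₁ f q → dot c (pos q) ≤ c₀
    below-c₀ {q} Mq = Equivalence.to (satisfies⇔dot (c₀ , c) q) (M₁⊆t q Mq)
    by-cases : 0ℚ < sqNorm c ⊎ c ≡ (0ℚ , 0ℚ) → dot c (pos p) ≤ c₀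
    by-cases (inj₁ 0<|c|²) = let (v , Mv , vp≤0) = edges⇒below-vertex c 0<|c|² p edges in
      ℚ.≤-trans (p-q≤0⇒p≤q (subst (_≤ 0ℚ) (dot-diff c v p) vp≤0)) (below-c₀ Mv)
    by-cases (inj₂ c≡0) = subst (_≤ c₀) (trans (vanish x) (sym (vanish p))) (below-c₀ Mx)
      where
      vanish : ∀ q → dot c (pos q) ≡ 0ℚ
      vanish q = trans (cong (λ c → dot c (pos q)) c≡0) (trans (dot-comm (0ℚ , 0ℚ) (pos q)) (dot-zeroʳ (pos q)))

  threshold-by-edges : IsThreshold* n f → (L : List (Point n)) → (∀ v → IsVertex f v → v ∈ L) →
                       IsThreshold n (length L) f
  threshold-by-edges thr L L⊇V = enclosed⇒threshold thr (λ i → edge (lookup L i))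
    (λ p Mp i → edge-M₁ (lookup L i) Mp)
    (λ p in-edges → edges⇒enclosed p λ {v} iv →
      subst (λ u → satisfies (edge u) p) (sym (lookup-index (L⊇V v iv))) (in-edges (index (L⊇V v iv))))

-- The collinear case

module Collinear {n : ℕ} (f : Fun n) {x y : Point n} (x≢y : x ≢ y) (Mx : M₁ f x) (My : M₁ f y)
                 (on-line : ∀ q → M₁ f q → cross (diff x y) (diff x q) ≡ 0ℚ) where
  open Vertices f

  d : ℚ²
  d = diff x y

  0<|d|² : 0ℚ < sqNorm d
  0<|d|² = 0<sqNorm-diff (x≢y ∘ sym)

  on-line-from : ∀ {v} q → M₁ f v → cross d (diff v q) ≡ cross d (diff x q)
  on-line-from {v} q Mv = trans (cross-diff-rebase d v x q)
    (trans (cong (λ t → cross d (diff x q) - t) (on-line v Mv)) (ℚ.+-identityʳ (cross d (diff x q))))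

  on-line-injective : ∀ {v q} → M₁ f v → M₁ f q → dot d (diff v q) ≡ 0ℚ → q ≡ v
  on-line-injective {v} {q} Mv Mq vq≡0 = diff-injective {v = v}
    (trans (dot-cross-zero d (diff v q) 0<|d|² vq≡0 (trans (on-line-from q Mv) (on-line q Mq))) (sym (diff-self v)))

  module Min = LexMax x Mx (negate d) (negate d)
  module Max = LexMax x Mx d d

  A B : Point n
  A = Min.lexMax
  B = Max.lexMax

  MA : M₁ f A
  MA = Min.lexMax-M₁

  MB : M₁ f B
  MB = Max.lexMax-M₁

  A-min : ∀ q → M₁ f q → 0ℚ ≤ dot d (diff A q)
  A-min q Mq = subst (0ℚ ≤_) (neg-involutive (dot d (diff A q)))
    (ℚ.neg-antimono-≤ (subst (_≤ 0ℚ) (dot-negate d (diff A q)) (proj₁ (Min.lexMax-max q Mq))))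

  B-max : ∀ q → M₁ f q → dot d (diff B q) ≤ 0ℚ
  B-max q Mq = proj₁ (Max.lexMax-max q Mq)

  A-vertex : IsVertex f A
  A-vertex = Min.lexMax-vertex λ e (Me , e≢A) −Ae≡0 _ →
    e≢A (on-line-injective MA Me (ℚ.neg-injective (trans (sym (dot-negate d (diff A e))) −Ae≡0)))

  B-vertex : IsVertex f B
  B-vertex = Max.lexMax-vertex λ e (Me , e≢B) Be≡0 _ → e≢B (on-line-injective MB Me Be≡0)

  0<AB : 0ℚ < dot d (diff A B)
  0<AB = subst (0ℚ <_) (sym (dot-diff d A B)) (p<q⇒0<q-p (begin-strict
    dot d (pos A)  ≤⟨ 0≤q-p⇒p≤q (subst (0ℚ ≤_) (dot-diff d A x) (A-min x Mx)) ⟩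
    dot d (pos x)  <⟨ 0<q-p⇒p<q (subst (0ℚ <_) (dot-diff d x y) 0<|d|²) ⟩
    dot d (pos y)  ≤⟨ p-q≤0⇒p≤q (subst (_≤ 0ℚ) (dot-diff d B y) (B-max y My)) ⟩
    dot d (pos B)  ∎))
    where open ℚ.≤-Reasoning

  -- Grid points off the line have |cross d (diff x p)| ≥ 1, so a strip through A and B whose
  -- sides have slope K against the line excludes them once K exceeds the range of dot d.
  range : ∃ λ M → 0ℚ ≤ M × (∀ {p} → p ∈ points n → dot d (diff A p) ⊔ - dot d (diff B p) ≤ M)
  range = bounded (λ p → dot d (diff A p) ⊔ - dot d (diff B p)) (points n)

  M : ℚ
  M = proj₁ range

  0≤M : 0ℚ ≤ M
  0≤M = proj₁ (proj₂ range)

  ≤M : ∀ p → dot d (diff A p) ⊔ - dot d (diff B p) ≤ M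
  ≤M p = proj₂ (proj₂ range) (∈-points p)

  K : ℚ
  K = M + 1ℚ

  opaque
    strip₁ strip₂ : Coeffs
    strip₁ = below (negate (tilt K d)) A
    strip₂ = below (tilt K d) B

  opaque
    unfolding strip₁

    strip₁⇔ : ∀ p → satisfies strip₁ p ⇔ K * cross d (diff A p) ≤ dot d (diff A p)
    strip₁⇔ p = mk⇔
      (λ s → p-q≤0⇒p≤q (subst (_≤ 0ℚ) eq (Equivalence.to (satisfies-below (negate (tilt K d)) A p) s)))
      (λ h → Equivalence.from (satisfies-below (negate (tilt K d)) A p) (subst (_≤ 0ℚ) (sym eq) (p≤q⇒p-q≤0 h)))
      where
      eq : dot (negate (tilt K d)) (diff A p) ≡ K * cross d (diff A p) - dot d (diff A p)
      eq = trans (dot-negate (tilt K d) (diff A p)) (trans (cong -_ (dot-tilt K d (diff A p)))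
        (solve 2 (λ a b → :- (a :- b) := b :- a) refl (dot d (diff A p)) (K * cross d (diff A p))))

    strip₂⇔ : ∀ p → satisfies strip₂ p ⇔ dot d (diff B p) ≤ K * cross d (diff B p)
    strip₂⇔ p = mk⇔
      (λ s → p-q≤0⇒p≤q (subst (_≤ 0ℚ) eq (Equivalence.to (satisfies-below (tilt K d) B p) s)))
      (λ h → Equivalence.from (satisfies-below (tilt K d) B p) (subst (_≤ 0ℚ) (sym eq) (p≤q⇒p-q≤0 h)))
      where
      eq : dot (tilt K d) (diff B p) ≡ dot d (diff B p) - K * cross d (diff B p)
      eq = dot-tilt K d (diff B p)

  M₁⊆strip : ∀ {q} → M₁ f q → satisfies strip₁ q × satisfies strip₂ q
  M₁⊆strip {q} Mq =
    Equivalence.from (strip₁⇔ q) (subst (_≤ dot d (diff A q)) (sym (K*cross≡0 MA)) (A-min q Mq)) ,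
    Equivalence.from (strip₂⇔ q) (subst (dot d (diff B q) ≤_) (sym (K*cross≡0 MB)) (B-max q Mq))
    where
    K*cross≡0 : ∀ {v} → M₁ f v → K * cross d (diff v q) ≡ 0ℚ
    K*cross≡0 Mv = trans (cong (K *_) (trans (on-line-from q Mv) (on-line q Mq))) (ℚ.*-zeroʳ K)

  strip⇒on-line : ∀ p → satisfies strip₁ p → satisfies strip₂ p → cross d (diff x p) ≡ 0ℚ
  strip⇒on-line p s₁ s₂ = by-sign (ℚ.<-cmp δ 0ℚ)
    where
    δ : ℚ
    δ = cross d (diff x p)
    K*δ≤M : K * δ ≤ M
    K*δ≤M = ℚ.≤-trans (subst (λ t → K * t ≤ dot d (diff A p)) (on-line-from p MA) (Equivalence.to (strip₁⇔ p) s₁))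
                      (ℚ.≤-trans (ℚ.p≤p⊔q (dot d (diff A p)) (- dot d (diff B p))) (≤M p))
    K*-δ≤M : K * - δ ≤ M
    K*-δ≤M = ℚ.≤-trans (subst (_≤ - dot d (diff B p)) eq (ℚ.neg-antimono-≤ (Equivalence.to (strip₂⇔ p) s₂)))
                       (ℚ.≤-trans (ℚ.p≤q⊔p (dot d (diff A p)) (- dot d (diff B p))) (≤M p))
      where
      eq : - (K * cross d (diff B p)) ≡ K * - δ
      eq = trans (ℚ.neg-distribʳ-* K (cross d (diff B p))) (cong (λ t → K * - t) (on-line-from p MB))
    by-sign : Tri (δ < 0ℚ) (δ ≡ 0ℚ) (0ℚ < δ) → δ ≡ 0ℚ
    by-sign (tri≈ _ δ≡0 _) = δ≡0
    by-sign (tri> _ _ 0<δ) =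
      ⊥-elim (ℚ.<-irrefl refl (ℚ.<-≤-trans (p<[p+1]*q 0≤M (isInteger∧0<p⇒1≤p (cross-diff-isInteger x y p) 0<δ)) K*δ≤M))
    by-sign (tri< δ<0 _ _) =
      ⊥-elim (ℚ.<-irrefl refl (ℚ.<-≤-trans (p<[p+1]*q 0≤M (isInteger∧p<0⇒1≤-p (cross-diff-isInteger x y p) δ<0)) K*-δ≤M))

  strip⇒enclosed : ∀ p → satisfies strip₁ p → satisfies strip₂ p → Enclosed p
  strip⇒enclosed p s₁ s₂ (c₀ , c) M₁⊆t = Equivalence.from (satisfies⇔dot (c₀ , c) p) (p-r≤q-r⇒p≤q
    (subst (_≤ h) (dot-diff c A p)
      (segment-bound d (diff A B) c (diff A p) h 0<|d|² AB≡0 Ap≡0 0<AB 0≤Ap Ap≤AB 0≤h AB≤h)))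
    where
    h : ℚ
    h = c₀ - dot c (pos A)
    below-c₀ : ∀ {q} → M₁ f q → dot c (pos q) ≤ c₀
    below-c₀ {q} Mq = Equivalence.to (satisfies⇔dot (c₀ , c) q) (M₁⊆t q Mq)
    0≤h : 0ℚ ≤ h
    0≤h = p≤q⇒0≤q-p (below-c₀ MA)
    AB≤h : dot c (diff A B) ≤ h
    AB≤h = subst (_≤ h) (sym (dot-diff c A B)) (ℚ.+-monoˡ-≤ (- dot c (pos A)) (below-c₀ MB))
    on = strip⇒on-line p s₁ s₂
    Ap≡0 : cross d (diff A p) ≡ 0ℚ
    Ap≡0 = trans (on-line-from p MA) on
    AB≡0 : cross d (diff A B) ≡ 0ℚ
    AB≡0 = trans (on-line-from B MA) (on-line B MB)
    0≤Ap : 0ℚ ≤ dot d (diff A p)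
    0≤Ap = subst (_≤ dot d (diff A p)) (trans (cong (K *_) Ap≡0) (ℚ.*-zeroʳ K)) (Equivalence.to (strip₁⇔ p) s₁)
    Bp≤0 : dot d (diff B p) ≤ 0ℚ
    Bp≤0 = subst (dot d (diff B p) ≤_) (trans (cong (K *_) (trans (on-line-from p MB) on)) (ℚ.*-zeroʳ K))
      (Equivalence.to (strip₂⇔ p) s₂)
    Ap≤AB : dot d (diff A p) ≤ dot d (diff A B)
    Ap≤AB = p-q≤0⇒p≤q (subst (_≤ 0ℚ) (dot-diff-rebase d B A p) Bp≤0)


  A≢B : A ≢ B
  A≢B A≡B = ℚ.<-irrefl (sym AA≡0) (subst (λ b → 0ℚ < dot d (diff A b)) (sym A≡B) 0<AB)
    where
    AA≡0 : dot d (diff A A) ≡ 0ℚ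
    AA≡0 = trans (cong (dot d) (diff-self A)) (dot-zeroʳ d)

  strips : ∀ m → Fin (suc (suc m)) → Coeffs
  strips m Fin.zero             = strip₁
  strips m (Fin.suc Fin.zero)   = strip₂
  strips m (Fin.suc (Fin.suc _)) = everywhere

  threshold-by-strip : IsThreshold* n f → (L : List (Point n)) → (∀ v → IsVertex f v → v ∈ L) →
                       IsThreshold n (length L) f
  threshold-by-strip thr L L⊇V = by-length (length≡2+ L (L⊇V A A-vertex) (L⊇V B B-vertex) A≢B)
    where
    by-length : (∃ λ m → length L ≡ suc (suc m)) → IsThreshold n (length L) f
    by-length (m , len) =
      subst (λ k → IsThreshold n k f) (sym len) (enclosed⇒threshold thr (strips m) M₁⊆strips strips⊆enclosed)
      where
      M₁⊆strips : ∀ p → M₁ f p → ∀ i → satisfies (strips m i) p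
      M₁⊆strips p Mp Fin.zero              = satisfies-≡ strip₁ (strips m Fin.zero) p refl (proj₁ (M₁⊆strip Mp))
      M₁⊆strips p Mp (Fin.suc Fin.zero)    = satisfies-≡ strip₂ (strips m (Fin.suc Fin.zero)) p refl (proj₂ (M₁⊆strip Mp))
      M₁⊆strips p Mp (Fin.suc (Fin.suc i)) =
        satisfies-≡ everywhere (strips m (Fin.suc (Fin.suc i))) p refl (satisfies-everywhere p)
      strips⊆enclosed : ∀ p → (∀ i → satisfies (strips m i) p) → Enclosed p
      strips⊆enclosed p in-strips = strip⇒enclosed p
        (satisfies-≡ (strips m Fin.zero) strip₁ p refl (in-strips Fin.zero))
        (satisfies-≡ (strips m (Fin.suc Fin.zero)) strip₂ p refl (in-strips (Fin.suc Fin.zero)))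

module _ {n : ℕ} (f : Fun n) where
  open Vertices f

  threshold-by-vertices : IsThreshold* n f → ∀ {x y} → x ≢ y → M₁ f x → M₁ f y →
    (L : List (Point n)) → (∀ v → IsVertex f v → v ∈ L) → IsThreshold n (length L) f
  threshold-by-vertices thr {x} {y} x≢y Mx My =
    by-cases (any-point? λ q → M₁? q ×-dec ¬? (cross (diff x y) (diff x q) ℚ.≟ 0ℚ))
    where
    by-cases : Dec (∃ λ q → M₁ f q × cross (diff x y) (diff x q) ≢ 0ℚ) →
               (L : List (Point n)) → (∀ v → IsVertex f v → v ∈ L) → IsThreshold n (length L) f
    by-cases (yes (q₀ , Mq₀ , off)) = NonCollinear.threshold-by-edges f x≢y Mx My Mq₀ off thr
    by-cases (no none) = Collinear.threshold-by-strip f x≢y Mx My on-line thr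
      where
      on-line : ∀ q → M₁ f q → cross (diff x y) (diff x q) ≡ 0ℚ
      on-line q Mq = decidable-stable (cross (diff x y) (diff x q) ℚ.≟ 0ℚ) λ off → none (q , Mq , off)

-- Essential points

InConv-mono : ∀ {n} {S S′ : Point n → Set} {v} → (∀ {p} → S p → S′ p) → InConv S v → InConv S′ v
InConv-mono S⊆S′ (ws , Sws , rest) = ws , All.map S⊆S′ Sws , rest

satisfies? : ∀ {n} t (p : Point n) → Dec (satisfies t p)
satisfies? t p = map′ (Equivalence.from (satisfies⇔dot t p)) (Equivalence.to (satisfies⇔dot t p))
  (dot (proj₂ t) (pos p) ℚ.≤? proj₁ t)

true≢false : true ≢ false
true≢false ()

bool-≢ : ∀ {b c : Bool} → b ≢ c → (b ≡ true × c ≡ false) ⊎ (b ≡ false × c ≡ true)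
bool-≢ {true}  {true}  b≢c = ⊥-elim (b≢c refl)
bool-≢ {true}  {false} _   = inj₁ (refl , refl)
bool-≢ {false} {true}  _   = inj₂ (refl , refl)
bool-≢ {false} {false} b≢c = ⊥-elim (b≢c refl)

module Flip {n : ℕ} {f g : Fun n} {x₀ : Point n} (agree : ∀ p → p ≢ x₀ → g p ≡ f p) where

  M₁-extension : f x₀ ≡ false → ∀ {p} → M₁ f p → M₁ g p
  M₁-extension fx₀≡false {p} Mfp with p ≟ₚ x₀
  ... | yes refl  = ⊥-elim (true≢false (trans (sym Mfp) fx₀≡false))
  ... | no  p≢x₀ = trans (agree p p≢x₀) Mfp

  vertex-of-extension : f x₀ ≡ false → ∀ {v} → IsVertex g v → v ≢ x₀ → IsVertex f v
  vertex-of-extension fx₀≡false {v} (Mgv , ¬conv) v≢x₀ =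
    trans (sym (agree v v≢x₀)) Mgv ,
    ¬conv ∘ InConv-mono {S = λ p → M₁ f p × p ≢ v} {S′ = λ p → M₁ g p × p ≢ v} {v}
      λ (Mfp , p≢v) → M₁-extension fx₀≡false Mfp , p≢v

  threshold-cut : ∀ {k} → IsThreshold n k f → ∀ c → g x₀ ≡ false → ¬ satisfies c x₀ →
                  (∀ p → M₁ g p → satisfies c p) → IsThreshold n (suc k) g
  threshold-cut {k} (a , f⇔a) c gx₀≡false x₀∉c M₁g⊆c = cs , λ p → mk⇔ (to p) (from p)
    where
    cs : Fin (suc k) → Coeffs
    cs Fin.zero    = c
    cs (Fin.suc i) = a i
    ≢x₀ : ∀ {p} → M₁ g p → p ≢ x₀
    ≢x₀ Mgp refl = true≢false (trans (sym Mgp) gx₀≡false)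
    to : ∀ p → g p ≡ true → ∀ i → satisfies (cs i) p
    to p Mgp Fin.zero    = M₁g⊆c p Mgp
    to p Mgp (Fin.suc i) = Equivalence.to (f⇔a p) (trans (sym (agree p (≢x₀ Mgp))) Mgp) i
    from : ∀ p → (∀ i → satisfies (cs i) p) → g p ≡ true
    from p in-cs = by-cases (p ≟ₚ x₀)
      where
      by-cases : Dec (p ≡ x₀) → g p ≡ true
      by-cases (yes refl)  = ⊥-elim (x₀∉c (in-cs Fin.zero))
      by-cases (no  p≢x₀) = trans (agree p p≢x₀) (Equivalence.from (f⇔a p) (in-cs ∘ Fin.suc))

module _ {n : ℕ} {f : Fun n} {x y : Point n} (x≢y : x ≢ y) (Mx : M₁ f x) (My : M₁ f y) where

  essential-bounded : IsThreshold* n f → (vs : List (Point n)) → (∀ v → IsVertex f v → v ∈ vs) →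
    ∀ x₀ → Essential (IsThreshold* n) f x₀ → Essential (IsThreshold n (suc (length vs))) f x₀
  essential-bounded thr vs vs⊇V x₀ (g , (k , b , g⇔b) , g≢f , agree) =
    g , by-flip (bool-≢ g≢f) , g≢f , agree
    where
    open Flip agree
    by-flip : (g x₀ ≡ true × f x₀ ≡ false) ⊎ (g x₀ ≡ false × f x₀ ≡ true) → IsThreshold n (suc (length vs)) g
    by-flip (inj₁ (_ , fx₀≡false)) = threshold-by-vertices g (k , b , g⇔b) x≢y
      (M₁-extension fx₀≡false Mx) (M₁-extension fx₀≡false My) (x₀ ∷ vs) λ v iv → by-cases v iv (v ≟ₚ x₀)
      where
      by-cases : ∀ v → IsVertex g v → Dec (v ≡ x₀) → v ∈ x₀ ∷ vs
      by-cases v _  (yes v≡x₀) = here v≡x₀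
      by-cases v iv (no  v≢x₀) = there (vs⊇V v (vertex-of-extension fx₀≡false iv v≢x₀))
    by-flip (inj₂ (gx₀≡false , _)) =
      threshold-cut (threshold-by-vertices f thr x≢y Mx My vs vs⊇V) (b j) gx₀≡false x₀∉bⱼ
        λ p Mgp → Equivalence.to (g⇔b p) Mgp j
      where
      violated : ∃ λ j → ¬ satisfies (b j) x₀
      violated = Fin.¬∀⟶∃¬ k (λ j → satisfies (b j) x₀) (λ j → satisfies? (b j) x₀)
        λ in-b → true≢false (trans (sym (Equivalence.from (g⇔b x₀) in-b)) gx₀≡false)
      j = proj₁ violated
      x₀∉bⱼ = proj₂ violated

proposition5 : (n : ℕ) → n ≥ 2 → (f : Fun n) → IsThreshold* n f →
    Σ (Point n) (λ x → Σ (Point n) (λ y → x ≢ y × M₁ f x × M₁ f y)) →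
    (vs : List (Point n)) → Unique vs → ((x : Point n) → (x ∈ vs) ⇔ IsVertex f x) →
    IsThreshold n (length vs) f ×
    ((x : Point n) → Essential (IsThreshold* n) f x ⇔ Essential (IsThreshold n (suc (length vs))) f x)
proposition5 n _ f thr (x , y , x≢y , Mx , My) vs _ vs⇔V =
  threshold-by-vertices f thr x≢y Mx My vs vs⊇V ,
  λ x₀ → mk⇔ (essential-bounded x≢y Mx My thr vs vs⊇V x₀)
             λ (g , thr-g , flip) → g , (suc (length vs) , thr-g) , flip
  where
  vs⊇V : ∀ v → IsVertex f v → v ∈ vs
  vs⊇V v = Equivalence.from (vs⇔V v)
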